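{- Let $a_1,a_2,b_1,b_2$ be positive integers and $f(q)=[a_1]_q[a_2]_q/([b_1]_q[b_2]_q)$. (1) $f(q)$ is a polynomial if and only if one of the following holds: (i) $b_1\mid a_1$ and $b_2\mid a_2$; (ii) $b_1\mid a_2$ and $b_2\mid a_1$; (iii) $b_1\mid a_1$, $b_2\mid a_1$ and $\gcd(b_1,b_2)\mid a_2$; (iv) $b_1\mid a_2$, $b_2\mid a_2$ and $\gcd(b_1,b_2)\mid a_1$. (2) If $f(q)$ is a power series with nonnegative coefficients, then $a_1,a_2\in\operatorname{Span}_{\mathbb{Z}_{\ge0}}\{b_1,b_2\}$. (3) $f(q)$ is a basic cyclotomic generating function if and only if both one of the divisibility conditions (i)–(iv) and the span condition $a_1,a_2\in\operatorname{Span}_{\mathbb{Z}_{\ge0}}\{b_1,b_2\}$ hold.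
   Context: $[n]_q=1+q+\cdots+q^{n-1}$. A basic cyclotomic generating function is a polynomial with nonnegative integer coefficients of the form $\prod_{j=1}^m[a_j]_q/[b_j]_q$ for multisets of positive integers $\{a_j\},\{b_j\}$. $\operatorname{Span}_{\mathbb{Z}_{\ge0}}\{b_1,b_2\}=\{xb_1+yb_2:x,y\in\mathbb{Z}_{\ge0}\}$. -}

module Defs where

open import Data.Nat as ℕ using (ℕ; zero; suc; _∸_; _<?_)
open import Data.Nat.Divisibility using (_∣_)
open import Data.Nat.GCD using (gcd)
open import Data.Integer using (ℤ; +_; _+_; _*_; _≤_)
open import Data.Product using (Σ; ∃; _×_; ∃-syntax)
open import Data.Sum using (_⊎_)
open import Relation.Binary.PropositionalEquality using (_≡_)
open import Relation.Nullary.Decidable using (⌊_⌋)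
open import Data.Bool using (if_then_else_)

Series : Set
Series = ℕ → ℤ

sumTo : (ℕ → ℤ) → ℕ → ℤ
sumTo f zero    = f zero
sumTo f (suc n) = sumTo f n + f (suc n)

_⊛_ : Series → Series → Series
(f ⊛ g) n = sumTo (λ k → f k * g (n ∸ k)) n

qint : ℕ → Series
qint n i = if ⌊ i <? n ⌋ then + 1 else + 0

-- P is the power series expansion of [a1][a2]/([b1][b2]) (the denominator has
-- constant term 1, so such P exists uniquely in ℤ[[q]]).
IsExpansion : ℕ → ℕ → ℕ → ℕ → Series → Set
IsExpansion a₁ a₂ b₁ b₂ P = ∀ n → ((qint b₁ ⊛ qint b₂) ⊛ P) n ≡ (qint a₁ ⊛ qint a₂) n

FiniteSupport : Series → Set
FiniteSupport P = ∃[ d ] (∀ n → d ℕ.≤ n → P n ≡ + 0)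

Nonneg : Series → Set
Nonneg P = ∀ n → + 0 ≤ P n

IsPolynomial : ℕ → ℕ → ℕ → ℕ → Set
IsPolynomial a₁ a₂ b₁ b₂ = ∃[ P ] (IsExpansion a₁ a₂ b₁ b₂ P × FiniteSupport P)

HasNonnegExpansion : ℕ → ℕ → ℕ → ℕ → Set
HasNonnegExpansion a₁ a₂ b₁ b₂ = ∃[ P ] (IsExpansion a₁ a₂ b₁ b₂ P × Nonneg P)

-- f(q) (already of the product-quotient form) is a basic cyclotomic generating
-- function: a polynomial with nonnegative integer coefficients.
IsBasicCGF : ℕ → ℕ → ℕ → ℕ → Set
IsBasicCGF a₁ a₂ b₁ b₂ = ∃[ P ] (IsExpansion a₁ a₂ b₁ b₂ P × FiniteSupport P × Nonneg P)

InSpan : ℕ → ℕ → ℕ → Set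
InSpan a b₁ b₂ = ∃[ x ] ∃[ y ] (a ≡ x ℕ.* b₁ ℕ.+ y ℕ.* b₂)

DivCond : ℕ → ℕ → ℕ → ℕ → Set
DivCond a₁ a₂ b₁ b₂ =
  ((b₁ ∣ a₁) × (b₂ ∣ a₂)) ⊎
  ((b₁ ∣ a₂) × (b₂ ∣ a₁)) ⊎
  ((b₁ ∣ a₁) × (b₂ ∣ a₁) × (gcd b₁ b₂ ∣ a₂)) ⊎
  ((b₁ ∣ a₂) × (b₂ ∣ a₂) × (gcd b₁ b₂ ∣ a₁))

-- Since [n]_q = (1 - q^n)/(1 - q), f = (1 - q^a₁)(1 - q^a₂) Σ_{x,y} q^(x b₁ + y b₂) in ℤ[[q]].
--
-- Pair the identity (1 - q^b₁)(1 - q^b₂) f = (1 - q^a₁)(1 - q^a₂) with a weight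
-- c : ℕ → ℤ; multiplication by 1 - q^m turns into the difference c n - c (n + m) on the weight.
-- When f is a polynomial, weights killed by the two b-differences are killed by the two
-- a-differences at 0. The weights [d ∣ n] for d ∣ b₁ or d ∣ b₂, and n [g ∣ n] for
-- g = gcd(b₁, b₂), force b₁ and b₂ to divide a₁ or a₂ and g to divide both, i.e. (i)–(iv).
-- The coefficient of q^a₁ in f is N(a₁) - N(a₁ - a₂) - 1, where N(n) counts representations
-- n = x b₁ + y b₂ (and N of a negative number is 0); so a nonnegative f forces a₁ into the span,
-- and symmetrically a₂.
--
-- In case (i) f = [a₁/b₁]_{q^b₁} [a₂/b₂]_{q^b₂}. In case (iii), with L = lcm(b₁, b₂)
-- dividing a₁, f = [a₁/L]_{q^L} (1 - q^a₂) S where S is the indicator series of the semigroup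
-- generated by b₁ and b₂. By Sylvester's theorem S agrees with the indicator of the multiples
-- of g from L on, so (1 - q^g) S is a polynomial, and (1 - q^a₂) S ≥ 0 as soon as a₂ itself
-- lies in the semigroup. Cases (ii) and (iv) are (i) and (iii) with a₁ and a₂ exchanged.

module Submission where

open import Defs
open import Data.Nat using (ℕ; _<_)
open import Data.Product using (_×_)
open import Function.Bundles using (_⇔_)

open import Algebra.Bundles using (CommutativeMonoid)
import Algebra.Solver.CommutativeMonoid as CommutativeMonoidSolver
open import Data.Bool using (if_then_else_)
open import Data.Empty using (⊥; ⊥-elim)
open import Data.Integer as ℤ using (ℤ; +_; _+_; _-_; -_; _*_)
import Data.Integer.Properties as ℤ
open import Data.Integer.Tactic.RingSolver using (solve-∀)
open import Data.Nat as ℕ using (zero; suc; _∸_; _≤_; z≤n; s≤s; NonZero)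
import Data.Nat.Properties as ℕ
open import Data.Nat.Divisibility hiding (quotient)
open import Data.Nat.DivMod using (_%_; _/_; m≡m%n+[m/n]*n; m%n<n)
open import Data.Nat.GCD using (gcd; gcd[m,n]∣m; gcd[m,n]∣n; gcd-GCD; module Bézout)
open import Data.Nat.Induction using (<-rec)
open import Data.Nat.LCM using (lcm; m∣lcm[m,n]; n∣lcm[m,n]; lcm-least; gcd*lcm)
open import Data.Nat.Tactic.RingSolver using () renaming (solve-∀ to ℕ-solve-∀)
open import Data.Product using (_,_; proj₂; ∃-syntax)
open import Data.Sum using (_⊎_; inj₁; inj₂; [_,_]′)
open import Function.Base using (_∘_)
open import Function.Bundles using (mk⇔; Equivalence)
open import Relation.Binary.Definitions using (tri<; tri≈; tri>)
open import Relation.Binary.PropositionalEquality hiding ([_])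
import Relation.Binary.Reasoning.Setoid as SetoidReasoning
open import Relation.Nullary using (¬_; Dec; yes; no)
open import Relation.Nullary.Decidable using (⌊_⌋)
open import Algebra.Properties.CommutativeSemigroup ℕ.+-commutativeSemigroup using (xy∙z≈xz∙y)

sumTo-cong : ∀ {f g} n → (∀ k → k ≤ n → f k ≡ g k) → sumTo f n ≡ sumTo g n
sumTo-cong zero    f≡g = f≡g 0 z≤n
sumTo-cong (suc n) f≡g =
  cong₂ _+_ (sumTo-cong n (λ k k≤n → f≡g k (ℕ.m≤n⇒m≤1+n k≤n))) (f≡g (suc n) ℕ.≤-refl)

sumTo-unfoldˡ : ∀ f n → sumTo f (suc n) ≡ f 0 + sumTo (f ∘ suc) n
sumTo-unfoldˡ f zero    = refl
sumTo-unfoldˡ f (suc n) =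
  trans (cong (_+ f (suc (suc n))) (sumTo-unfoldˡ f n)) (ℤ.+-assoc (f 0) _ _)

sumTo-+ : ∀ f g n → sumTo (λ k → f k + g k) n ≡ sumTo f n + sumTo g n
sumTo-+ f g zero    = refl
sumTo-+ f g (suc n) =
  trans (cong (_+ (f (suc n) + g (suc n))) (sumTo-+ f g n))
        (interchange (sumTo f n) (sumTo g n) (f (suc n)) (g (suc n)))
  where
  interchange : ∀ a b c d → (a + b) + (c + d) ≡ (a + c) + (b + d)
  interchange = solve-∀

sumTo-*ˡ : ∀ c f n → sumTo (λ k → c * f k) n ≡ c * sumTo f n
sumTo-*ˡ c f zero    = refl
sumTo-*ˡ c f (suc n) =
  trans (cong (_+ c * f (suc n)) (sumTo-*ˡ c f n)) (sym (ℤ.*-distribˡ-+ c _ _))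

sumTo-zero : ∀ n → sumTo (λ _ → + 0) n ≡ + 0
sumTo-zero zero    = refl
sumTo-zero (suc n) = cong (_+ + 0) (sumTo-zero n)

sumTo-neg : ∀ f n → sumTo (λ k → - f k) n ≡ - sumTo f n
sumTo-neg f zero    = refl
sumTo-neg f (suc n) =
  trans (cong (_+ - f (suc n)) (sumTo-neg f n)) (sym (ℤ.neg-distrib-+ (sumTo f n) (f (suc n))))

0ₛ : Series
0ₛ _ = + 0

_+ₛ_ : Series → Series → Series
(f +ₛ g) n = f n + g n

_-ₛ_ : Series → Series → Series
(f -ₛ g) n = f n - g n

_·ₛ_ : ℤ → Series → Series
(c ·ₛ f) n = c * f n

infixl 6 _+ₛ_ _-ₛ_
infixl 7 _·ₛ_

⊛-congˡ : ∀ {f f′} g → f ≗ f′ → f ⊛ g ≗ f′ ⊛ g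
⊛-congˡ g f≗f′ n = sumTo-cong n (λ k _ → cong (_* g (n ∸ k)) (f≗f′ k))

⊛-congʳ : ∀ f {g g′} → g ≗ g′ → f ⊛ g ≗ f ⊛ g′
⊛-congʳ f g≗g′ n = sumTo-cong n (λ k _ → cong (f k *_) (g≗g′ (n ∸ k)))

⊛-unfoldˡ : ∀ f g n → (f ⊛ g) (suc n) ≡ f 0 * g (suc n) + ((f ∘ suc) ⊛ g) n
⊛-unfoldˡ f g n = sumTo-unfoldˡ (λ k → f k * g (suc n ∸ k)) n

⊛-unfoldʳ : ∀ f g n → (f ⊛ g) (suc n) ≡ (f ⊛ (g ∘ suc)) n + f (suc n) * g 0
⊛-unfoldʳ f g n =
  cong₂ _+_ (sumTo-cong n (λ k k≤n → cong (λ i → f k * g i) (ℕ.+-∸-assoc 1 k≤n)))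
            (cong (λ i → f (suc n) * g i) (ℕ.n∸n≡0 n))

⊛-comm : ∀ f g → f ⊛ g ≗ g ⊛ f
⊛-comm f g zero    = ℤ.*-comm (f 0) (g 0)
⊛-comm f g (suc n) = begin
  (f ⊛ g) (suc n)                         ≡⟨ ⊛-unfoldˡ f g n ⟩
  f 0 * g (suc n) + ((f ∘ suc) ⊛ g) n
    ≡⟨ cong₂ _+_ (ℤ.*-comm (f 0) (g (suc n))) (⊛-comm (f ∘ suc) g n) ⟩
  g (suc n) * f 0 + (g ⊛ (f ∘ suc)) n     ≡⟨ ℤ.+-comm (g (suc n) * f 0) _ ⟩
  (g ⊛ (f ∘ suc)) n + g (suc n) * f 0     ≡⟨ ⊛-unfoldʳ g f n ⟨
  (g ⊛ f) (suc n)                         ∎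
  where open ≡-Reasoning

⊛-distribʳ-+ₛ : ∀ f f′ g → (f +ₛ f′) ⊛ g ≗ f ⊛ g +ₛ f′ ⊛ g
⊛-distribʳ-+ₛ f f′ g n =
  trans (sumTo-cong n (λ k _ → ℤ.*-distribʳ-+ (g (n ∸ k)) (f k) (f′ k)))
        (sumTo-+ (λ k → f k * g (n ∸ k)) (λ k → f′ k * g (n ∸ k)) n)

⊛-distribʳ-subₛ : ∀ f f′ g → (f -ₛ f′) ⊛ g ≗ f ⊛ g -ₛ f′ ⊛ g
⊛-distribʳ-subₛ f f′ g n =
  trans (sumTo-cong n (λ k _ → distrib (f k) (f′ k) (g (n ∸ k))))
        (trans (sumTo-+ (λ k → f k * g (n ∸ k)) (λ k → - (f′ k * g (n ∸ k))) n)
               (cong (λ x → (f ⊛ g) n + x) (sumTo-neg (λ k → f′ k * g (n ∸ k)) n)))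
  where
  distrib : ∀ a b c → (a - b) * c ≡ a * c + - (b * c)
  distrib = solve-∀

⊛-distribˡ-+ₛ : ∀ f g g′ → f ⊛ (g +ₛ g′) ≗ f ⊛ g +ₛ f ⊛ g′
⊛-distribˡ-+ₛ f g g′ n = begin
  (f ⊛ (g +ₛ g′)) n             ≡⟨ ⊛-comm f (g +ₛ g′) n ⟩
  ((g +ₛ g′) ⊛ f) n             ≡⟨ ⊛-distribʳ-+ₛ g g′ f n ⟩
  (g ⊛ f) n + (g′ ⊛ f) n        ≡⟨ cong₂ _+_ (⊛-comm g f n) (⊛-comm g′ f n) ⟩
  (f ⊛ g) n + (f ⊛ g′) n        ∎
  where open ≡-Reasoning

⊛-·ₛˡ : ∀ c f g → (c ·ₛ f) ⊛ g ≗ c ·ₛ (f ⊛ g)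
⊛-·ₛˡ c f g n =
  trans (sumTo-cong n (λ k _ → ℤ.*-assoc c (f k) (g (n ∸ k)))) (sumTo-*ˡ c (λ k → f k * g (n ∸ k)) n)

⊛-zeroʳ : ∀ f → f ⊛ 0ₛ ≗ 0ₛ
⊛-zeroʳ f n = trans (sumTo-cong n (λ k _ → ℤ.*-zeroʳ (f k))) (sumTo-zero n)

⊛-zeroˡ : ∀ f → 0ₛ ⊛ f ≗ 0ₛ
⊛-zeroˡ f n = trans (⊛-comm 0ₛ f n) (⊛-zeroʳ f n)

⊛-assoc : ∀ f g h → (f ⊛ g) ⊛ h ≗ f ⊛ (g ⊛ h)
⊛-assoc f g h zero    = ℤ.*-assoc (f 0) (g 0) (h 0)
⊛-assoc f g h (suc n) = begin
  ((f ⊛ g) ⊛ h) (suc n)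
    ≡⟨ ⊛-unfoldˡ (f ⊛ g) h n ⟩
  (f 0 * g 0) * h (suc n) + (((f ⊛ g) ∘ suc) ⊛ h) n
    ≡⟨ cong (λ x → (f 0 * g 0) * h (suc n) + x) (begin
        (((f ⊛ g) ∘ suc) ⊛ h) n
          ≡⟨ ⊛-congˡ h (⊛-unfoldˡ f g) n ⟩
        ((f 0 ·ₛ (g ∘ suc) +ₛ (f ∘ suc) ⊛ g) ⊛ h) n
          ≡⟨ ⊛-distribʳ-+ₛ (f 0 ·ₛ (g ∘ suc)) ((f ∘ suc) ⊛ g) h n ⟩
        ((f 0 ·ₛ (g ∘ suc)) ⊛ h) n + (((f ∘ suc) ⊛ g) ⊛ h) n
          ≡⟨ cong₂ _+_ (⊛-·ₛˡ (f 0) (g ∘ suc) h n) (⊛-assoc (f ∘ suc) g h n) ⟩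
        f 0 * ((g ∘ suc) ⊛ h) n + ((f ∘ suc) ⊛ (g ⊛ h)) n ∎) ⟩
  (f 0 * g 0) * h (suc n) + (f 0 * ((g ∘ suc) ⊛ h) n + ((f ∘ suc) ⊛ (g ⊛ h)) n)
    ≡⟨ factor (f 0) (g 0) (h (suc n)) (((g ∘ suc) ⊛ h) n) (((f ∘ suc) ⊛ (g ⊛ h)) n) ⟩
  f 0 * (g 0 * h (suc n) + ((g ∘ suc) ⊛ h) n) + ((f ∘ suc) ⊛ (g ⊛ h)) n
    ≡⟨ cong (λ x → f 0 * x + ((f ∘ suc) ⊛ (g ⊛ h)) n) (⊛-unfoldˡ g h n) ⟨
  f 0 * (g ⊛ h) (suc n) + ((f ∘ suc) ⊛ (g ⊛ h)) n
    ≡⟨ ⊛-unfoldˡ f (g ⊛ h) n ⟨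
  (f ⊛ (g ⊛ h)) (suc n) ∎
  where
  open ≡-Reasoning
  factor : ∀ a b c x y → (a * b) * c + (a * x + y) ≡ a * (b * c + x) + y
  factor = solve-∀

infix 25 q^_
q^_ : ℕ → Series
(q^ zero)  zero    = + 1
(q^ zero)  (suc n) = + 0
(q^ suc m) zero    = + 0
(q^ suc m) (suc n) = (q^ m) n

1ₛ : Series
1ₛ = q^ 0

⊛-identityˡ : ∀ f → 1ₛ ⊛ f ≗ f
⊛-identityˡ f zero    = ℤ.*-identityˡ (f 0)
⊛-identityˡ f (suc n) = begin
  (1ₛ ⊛ f) (suc n)                 ≡⟨ ⊛-unfoldˡ 1ₛ f n ⟩
  + 1 * f (suc n) + (0ₛ ⊛ f) n     ≡⟨ cong₂ _+_ (ℤ.*-identityˡ (f (suc n))) (⊛-zeroˡ f n) ⟩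
  f (suc n) + + 0                  ≡⟨ ℤ.+-identityʳ (f (suc n)) ⟩
  f (suc n)                        ∎
  where open ≡-Reasoning

⊛-identityʳ : ∀ f → f ⊛ 1ₛ ≗ f
⊛-identityʳ f n = trans (⊛-comm f 1ₛ n) (⊛-identityˡ f n)

⊛-commutativeMonoid : CommutativeMonoid _ _
⊛-commutativeMonoid = record
  { Carrier = Series ; _≈_ = _≗_ ; _∙_ = _⊛_ ; ε = 1ₛ
  ; isCommutativeMonoid = record
    { isMonoid = record
      { isSemigroup = record
        { isMagma = record
          { isEquivalence = record
            { refl = λ _ → refl ; sym = λ p n → sym (p n) ; trans = λ p q n → trans (p n) (q n) }
          ; ∙-cong = λ {f} {f′} {g} p q n → trans (⊛-congˡ g p n) (⊛-congʳ f′ q n) }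
        ; assoc = ⊛-assoc }
      ; identity = ⊛-identityˡ , ⊛-identityʳ }
    ; comm = ⊛-comm } }

open CommutativeMonoid ⊛-commutativeMonoid
  using () renaming (setoid to seriesSetoid; refl to ≗-refl; sym to ≗-sym; ∙-cong to ⊛-cong)
open CommutativeMonoidSolver ⊛-commutativeMonoid using (solve; _⊕_; _⊜_)
module ≗-Reasoning = SetoidReasoning seriesSetoid

shift : ℕ → Series → Series
shift zero    X n       = X n
shift (suc m) X zero    = + 0
shift (suc m) X (suc n) = shift m X n

q^-⊛ : ∀ m X → q^ m ⊛ X ≗ shift m X
q^-⊛ zero    X n       = ⊛-identityˡ X n
q^-⊛ (suc m) X zero    = ℤ.*-zeroˡ (X 0)
q^-⊛ (suc m) X (suc n) =
  trans (⊛-unfoldˡ (q^ suc m) X n)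
        (trans (cong₂ _+_ (ℤ.*-zeroˡ (X (suc n))) (q^-⊛ m X n)) (ℤ.+-identityˡ _))

shift-< : ∀ m X {n} → n < m → shift m X n ≡ + 0
shift-< (suc m) X {zero}  _         = refl
shift-< (suc m) X {suc n} (s≤s n<m) = shift-< m X n<m

shift-+ : ∀ m X k → shift m X (m ℕ.+ k) ≡ X k
shift-+ zero    X k = refl
shift-+ (suc m) X k = shift-+ m X k

shift-view : ∀ m X n → (n < m × shift m X n ≡ + 0) ⊎ ∃[ k ] (n ≡ m ℕ.+ k × shift m X n ≡ X k)
shift-view zero    X n       = inj₂ (n , refl , refl)
shift-view (suc m) X zero    = inj₁ (s≤s z≤n , refl)
shift-view (suc m) X (suc n) with shift-view m X n
... | inj₁ (n<m , x≡0)     = inj₁ (s≤s n<m , x≡0)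
... | inj₂ (k , n≡m+k , x≡) = inj₂ (k , cong suc n≡m+k , x≡)

shift-q^ : ∀ m j → shift m (q^ j) ≗ q^ (m ℕ.+ j)
shift-q^ zero    j n       = refl
shift-q^ (suc m) j zero    = refl
shift-q^ (suc m) j (suc n) = shift-q^ m j n

infix 25 1-q^_
1-q^_ : ℕ → Series
1-q^ m = 1ₛ -ₛ q^ m

1-q^-⊛ : ∀ m X n → ((1-q^ m) ⊛ X) n ≡ X n - shift m X n
1-q^-⊛ m X n =
  trans (⊛-distribʳ-subₛ 1ₛ (q^ m) X n) (cong₂ _-_ (⊛-identityˡ X n) (q^-⊛ m X n))

shift-cong-below : ∀ {m} → 1 ≤ m → ∀ {X Y n} → (∀ {k} → k < n → X k ≡ Y k) →
                   shift m X n ≡ shift m Y n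
shift-cong-below {m} 1≤m {X} {Y} {n} X≡Y with shift-view m X n
... | inj₁ (n<m , x≡0)         = trans x≡0 (sym (shift-< m Y n<m))
... | inj₂ (k , refl , x≡Xk) =
  trans x≡Xk (trans (X≡Y k<m+k) (sym (shift-+ m Y k)))
  where
  k<m+k : k < m ℕ.+ k
  k<m+k = ℕ.+-monoˡ-≤ k 1≤m

1-q^-cancelˡ : ∀ {m} → 1 ≤ m → ∀ {X Y} → (1-q^ m) ⊛ X ≗ (1-q^ m) ⊛ Y → X ≗ Y
1-q^-cancelˡ {m} 1≤m {X} {Y} eq = <-rec (λ n → X n ≡ Y n) step
  where
  step : ∀ n → (∀ {k} → k < n → X k ≡ Y k) → X n ≡ Y n
  step n ih = begin
    X n                            ≡⟨ m-n+n≡m (X n) (shift m X n) ⟨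
    (X n - shift m X n) + shift m X n
      ≡⟨ cong₂ _+_ (trans (sym (1-q^-⊛ m X n)) (trans (eq n) (1-q^-⊛ m Y n)))
                   (shift-cong-below 1≤m ih) ⟩
    (Y n - shift m Y n) + shift m Y n ≡⟨ m-n+n≡m (Y n) (shift m Y n) ⟩
    Y n                            ∎
    where
    open ≡-Reasoning
    m-n+n≡m : ∀ m n → m - n + n ≡ m
    m-n+n≡m = solve-∀

IsIndicator : Set → ℤ → Set
IsIndicator A z = (A × z ≡ + 1) ⊎ (¬ A × z ≡ + 0)

dec-isIndicator : ∀ {A} (a? : Dec A) → IsIndicator A (if ⌊ a? ⌋ then + 1 else + 0)
dec-isIndicator (yes a) = inj₁ (a , refl)
dec-isIndicator (no ¬a) = inj₂ (¬a , refl)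

isIndicator-yes : ∀ {A z} → IsIndicator A z → A → z ≡ + 1
isIndicator-yes (inj₁ (_ , z≡1))  _ = z≡1
isIndicator-yes (inj₂ (¬a , _))   a = ⊥-elim (¬a a)

isIndicator-no : ∀ {A z} → IsIndicator A z → ¬ A → z ≡ + 0
isIndicator-no (inj₁ (a , _))    ¬a = ⊥-elim (¬a a)
isIndicator-no (inj₂ (_ , z≡0))  _  = z≡0

isIndicator-unique : ∀ {A B z w} → (A → B) → (B → A) →
                     IsIndicator A z → IsIndicator B w → z ≡ w
isIndicator-unique A→B B→A (inj₁ (a , z≡1))  w = trans z≡1 (sym (isIndicator-yes w (A→B a)))
isIndicator-unique A→B B→A (inj₂ (¬a , z≡0)) w = trans z≡0 (sym (isIndicator-no w (¬a ∘ B→A)))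

isIndicator-resp : ∀ {A B z} → (A → B) → (B → A) → IsIndicator A z → IsIndicator B z
isIndicator-resp A→B B→A (inj₁ (a , z≡1))  = inj₁ (A→B a , z≡1)
isIndicator-resp A→B B→A (inj₂ (¬a , z≡0)) = inj₂ (¬a ∘ B→A , z≡0)

isIndicator-nonneg : ∀ {A z} → IsIndicator A z → + 0 ℤ.≤ z
isIndicator-nonneg (inj₁ (_ , refl)) = ℤ.+≤+ z≤n
isIndicator-nonneg (inj₂ (_ , refl)) = ℤ.+≤+ z≤n

isIndicator-mono : ∀ {A B z w} → (A → B) → IsIndicator A z → IsIndicator B w → z ℤ.≤ w
isIndicator-mono A→B (inj₁ (a , refl)) w = ℤ.≤-reflexive (sym (isIndicator-yes w (A→B a)))
isIndicator-mono A→B (inj₂ (_ , refl)) w = isIndicator-nonneg w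

qint-isIndicator : ∀ m i → IsIndicator (i < m) (qint m i)
qint-isIndicator m i = dec-isIndicator (i ℕ.<? m)

q^-isIndicator : ∀ m n → IsIndicator (n ≡ m) ((q^ m) n)
q^-isIndicator zero    zero    = inj₁ (refl , refl)
q^-isIndicator zero    (suc n) = inj₂ ((λ ()) , refl)
q^-isIndicator (suc m) zero    = inj₂ ((λ ()) , refl)
q^-isIndicator (suc m) (suc n) with q^-isIndicator m n
... | inj₁ (n≡m , x≡1)  = inj₁ (cong suc n≡m , x≡1)
... | inj₂ (n≢m , x≡0)  = inj₂ (n≢m ∘ ℕ.suc-injective , x≡0)

1-q-⊛-qint : ∀ m → 1-q^ 1 ⊛ qint m ≗ 1-q^ m
1-q-⊛-qint m n = trans (1-q^-⊛ 1 (qint m) n) (difference m n)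
  where
  difference : ∀ m n → qint m n - shift 1 (qint m) n ≡ (1-q^ m) n
  difference zero    zero    = refl
  difference zero    (suc k) = refl
  difference (suc m) zero    = refl
  difference (suc m) (suc k) with ℕ.<-cmp k m
  ... | tri< k<m k≢m _ rewrite isIndicator-yes (qint-isIndicator (suc m) (suc k)) (s≤s k<m)
                            | isIndicator-yes (qint-isIndicator (suc m) k) (ℕ.m≤n⇒m≤1+n k<m)
                            | isIndicator-no (q^-isIndicator m k) k≢m = refl
  ... | tri≈ _ refl _ rewrite isIndicator-no (qint-isIndicator (suc k) (suc k)) (ℕ.n≮n (suc k))
                            | isIndicator-yes (qint-isIndicator (suc k) k) ℕ.≤-refl
                            | isIndicator-yes (q^-isIndicator k k) refl = refl
  ... | tri> _ k≢m m<k rewrite isIndicator-no (qint-isIndicator (suc m) (suc k)) (ℕ.<⇒≱ (s≤s m<k) ∘ ℕ.<⇒≤)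
                            | isIndicator-no (qint-isIndicator (suc m) k) (ℕ.<⇒≱ m<k ∘ ℕ.≤-pred)
                            | isIndicator-no (q^-isIndicator m k) k≢m = refl

multiples : ℕ → Series
multiples d n = if ⌊ d ∣? n ⌋ then + 1 else + 0

multiples-isIndicator : ∀ d n → IsIndicator (d ∣ n) (multiples d n)
multiples-isIndicator d n = dec-isIndicator (d ∣? n)

multiples-nonneg : ∀ d → Nonneg (multiples d)
multiples-nonneg d n = isIndicator-nonneg (multiples-isIndicator d n)

multiples-periodic : ∀ {d p} → d ∣ p → ∀ n → multiples d (n ℕ.+ p) ≡ multiples d n
multiples-periodic {d} {p} d∣p n =
  isIndicator-unique (λ d∣n+p → ∣m+n∣m⇒∣n (subst (d ∣_) (ℕ.+-comm n p) d∣n+p) d∣p)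
                     (λ d∣n → ∣m∣n⇒∣m+n d∣n d∣p)
                     (multiples-isIndicator d (n ℕ.+ p)) (multiples-isIndicator d n)

1-q^-⊛-multiples : ∀ {m} → 1 ≤ m → (1-q^ m) ⊛ multiples m ≗ 1ₛ
1-q^-⊛-multiples {m} 1≤m n with shift-view m (multiples m) n
... | inj₁ (n<m , s≡0) = begin
  ((1-q^ m) ⊛ multiples m) n       ≡⟨ 1-q^-⊛ m (multiples m) n ⟩
  multiples m n - shift m (multiples m) n ≡⟨ cong (λ x → multiples m n - x) s≡0 ⟩
  multiples m n - + 0              ≡⟨ ℤ.+-identityʳ (multiples m n) ⟩
  multiples m n                    ≡⟨ isIndicator-unique (m∣n⇒n≡0 n<m) (λ { refl → m ∣0 })
                                        (multiples-isIndicator m n) (q^-isIndicator 0 n) ⟩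
  1ₛ n                             ∎
  where
  open ≡-Reasoning
  m∣n⇒n≡0 : ∀ {n} → n < m → m ∣ n → n ≡ 0
  m∣n⇒n≡0 {zero}  _   _   = refl
  m∣n⇒n≡0 {suc _} n<m m∣n = ⊥-elim (ℕ.<⇒≱ n<m (∣⇒≤ m∣n))
... | inj₂ (k , refl , s≡) = begin
  ((1-q^ m) ⊛ multiples m) (m ℕ.+ k)                  ≡⟨ 1-q^-⊛ m (multiples m) (m ℕ.+ k) ⟩
  multiples m (m ℕ.+ k) - shift m (multiples m) (m ℕ.+ k)
    ≡⟨ cong₂ _-_ (trans (cong (multiples m) (ℕ.+-comm m k)) (multiples-periodic ∣-refl k)) s≡ ⟩
  multiples m k - multiples m k                        ≡⟨ ℤ.+-inverseʳ (multiples m k) ⟩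
  + 0                                                  ≡⟨ isIndicator-no (q^-isIndicator 0 (m ℕ.+ k)) m+k≢0 ⟨
  1ₛ (m ℕ.+ k)                                         ∎
  where
  open ≡-Reasoning
  m+k≢0 : m ℕ.+ k ≢ 0
  m+k≢0 m+k≡0 = ℕ.<⇒≢ (ℕ.<-≤-trans 1≤m (ℕ.m≤m+n m k)) (sym m+k≡0)

multiplesBelow : ℕ → ℕ → Series
multiplesBelow m zero    = 0ₛ
multiplesBelow m (suc k) = multiplesBelow m k +ₛ q^ (k ℕ.* m)

1-q^-⊛-multiplesBelow : ∀ m k → (1-q^ m) ⊛ multiplesBelow m k ≗ 1-q^ (k ℕ.* m)
1-q^-⊛-multiplesBelow m zero    n = trans (⊛-zeroʳ (1-q^ m) n) (sym (ℤ.+-inverseʳ (1ₛ n)))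
1-q^-⊛-multiplesBelow m (suc k) n = begin
  ((1-q^ m) ⊛ (multiplesBelow m k +ₛ q^ (k ℕ.* m))) n
    ≡⟨ ⊛-distribˡ-+ₛ (1-q^ m) (multiplesBelow m k) (q^ (k ℕ.* m)) n ⟩
  ((1-q^ m) ⊛ multiplesBelow m k) n + ((1-q^ m) ⊛ q^ (k ℕ.* m)) n
    ≡⟨ cong₂ _+_ (1-q^-⊛-multiplesBelow m k n)
                 (trans (1-q^-⊛ m (q^ (k ℕ.* m)) n)
                        (cong (λ x → (q^ (k ℕ.* m)) n - x) (shift-q^ m (k ℕ.* m) n))) ⟩
  (1ₛ n - (q^ (k ℕ.* m)) n) + ((q^ (k ℕ.* m)) n - (q^ (m ℕ.+ k ℕ.* m)) n)
    ≡⟨ telescope (1ₛ n) ((q^ (k ℕ.* m)) n) ((q^ (m ℕ.+ k ℕ.* m)) n) ⟩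
  1ₛ n - (q^ (m ℕ.+ k ℕ.* m)) n ∎
  where
  open ≡-Reasoning
  telescope : ∀ a b c → (a - b) + (b - c) ≡ a - c
  telescope = solve-∀

1-q^-multiple-⊛ : ∀ m k X → (1-q^ (k ℕ.* m)) ⊛ X ≗ multiplesBelow m k ⊛ ((1-q^ m) ⊛ X)
1-q^-multiple-⊛ m k X = begin
  (1-q^ (k ℕ.* m)) ⊛ X                          ≈⟨ ⊛-congˡ X (1-q^-⊛-multiplesBelow m k) ⟨
  ((1-q^ m) ⊛ multiplesBelow m k) ⊛ X           ≈⟨ solve 3 (λ d t x → (d ⊕ t) ⊕ x ⊜ t ⊕ (d ⊕ x))
                                                        ≗-refl (1-q^ m) (multiplesBelow m k) X ⟩
  multiplesBelow m k ⊛ ((1-q^ m) ⊛ X)           ∎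
  where open ≗-Reasoning

1-q^-multiple-⊛-multiples : ∀ {m} → 1 ≤ m → ∀ k → (1-q^ (k ℕ.* m)) ⊛ multiples m ≗ multiplesBelow m k
1-q^-multiple-⊛-multiples {m} 1≤m k = begin
  (1-q^ (k ℕ.* m)) ⊛ multiples m                ≈⟨ 1-q^-multiple-⊛ m k (multiples m) ⟩
  multiplesBelow m k ⊛ ((1-q^ m) ⊛ multiples m) ≈⟨ ⊛-congʳ (multiplesBelow m k) (1-q^-⊛-multiples 1≤m) ⟩
  multiplesBelow m k ⊛ 1ₛ                       ≈⟨ ⊛-identityʳ (multiplesBelow m k) ⟩
  multiplesBelow m k                            ∎
  where open ≗-Reasoning

1-q²-⊛-qint² : ∀ a b X →
  (1-q^ 1) ⊛ ((1-q^ 1) ⊛ ((qint a ⊛ qint b) ⊛ X)) ≗ (1-q^ a) ⊛ ((1-q^ b) ⊛ X)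
1-q²-⊛-qint² a b X = begin
  (1-q^ 1) ⊛ ((1-q^ 1) ⊛ ((qint a ⊛ qint b) ⊛ X))
    ≈⟨ solve 4 (λ d x y z → d ⊕ (d ⊕ ((x ⊕ y) ⊕ z)) ⊜ (d ⊕ x) ⊕ ((d ⊕ y) ⊕ z))
             ≗-refl (1-q^ 1) (qint a) (qint b) X ⟩
  ((1-q^ 1) ⊛ qint a) ⊛ (((1-q^ 1) ⊛ qint b) ⊛ X)
    ≈⟨ ⊛-cong (1-q-⊛-qint a) (⊛-congˡ X (1-q-⊛-qint b)) ⟩
  (1-q^ a) ⊛ ((1-q^ b) ⊛ X) ∎
  where open ≗-Reasoning

isExpansion⇔cleared : ∀ {a₁ a₂ b₁ b₂ P} →
  IsExpansion a₁ a₂ b₁ b₂ P ⇔ ((1-q^ b₁) ⊛ ((1-q^ b₂) ⊛ P) ≗ (1-q^ a₁) ⊛ (1-q^ a₂))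
isExpansion⇔cleared {a₁} {a₂} {b₁} {b₂} {P} = mk⇔ clear unclear
  where
  open ≗-Reasoning
  D² : Series → Series
  D² X = (1-q^ 1) ⊛ ((1-q^ 1) ⊛ X)
  qa²≗ : D² (qint a₁ ⊛ qint a₂) ≗ (1-q^ a₁) ⊛ (1-q^ a₂)
  qa²≗ = begin
    D² (qint a₁ ⊛ qint a₂)
      ≈⟨ ⊛-congʳ (1-q^ 1) (⊛-congʳ (1-q^ 1) (⊛-identityʳ (qint a₁ ⊛ qint a₂))) ⟨
    D² ((qint a₁ ⊛ qint a₂) ⊛ 1ₛ)      ≈⟨ 1-q²-⊛-qint² a₁ a₂ 1ₛ ⟩
    (1-q^ a₁) ⊛ ((1-q^ a₂) ⊛ 1ₛ)       ≈⟨ ⊛-congʳ (1-q^ a₁) (⊛-identityʳ (1-q^ a₂)) ⟩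
    (1-q^ a₁) ⊛ (1-q^ a₂)              ∎
  clear : IsExpansion a₁ a₂ b₁ b₂ P → (1-q^ b₁) ⊛ ((1-q^ b₂) ⊛ P) ≗ (1-q^ a₁) ⊛ (1-q^ a₂)
  clear expansion = begin
    (1-q^ b₁) ⊛ ((1-q^ b₂) ⊛ P)        ≈⟨ 1-q²-⊛-qint² b₁ b₂ P ⟨
    D² ((qint b₁ ⊛ qint b₂) ⊛ P)       ≈⟨ ⊛-congʳ (1-q^ 1) (⊛-congʳ (1-q^ 1) expansion) ⟩
    D² (qint a₁ ⊛ qint a₂)             ≈⟨ qa²≗ ⟩
    (1-q^ a₁) ⊛ (1-q^ a₂)              ∎
  unclear : (1-q^ b₁) ⊛ ((1-q^ b₂) ⊛ P) ≗ (1-q^ a₁) ⊛ (1-q^ a₂) → IsExpansion a₁ a₂ b₁ b₂ P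
  unclear cleared = 1-q^-cancelˡ ℕ.≤-refl (1-q^-cancelˡ ℕ.≤-refl (begin
    D² ((qint b₁ ⊛ qint b₂) ⊛ P)       ≈⟨ 1-q²-⊛-qint² b₁ b₂ P ⟩
    (1-q^ b₁) ⊛ ((1-q^ b₂) ⊛ P)        ≈⟨ cleared ⟩
    (1-q^ a₁) ⊛ (1-q^ a₂)              ≈⟨ qa²≗ ⟨
    D² (qint a₁ ⊛ qint a₂)             ∎))

-- The closed form of f, with 1/(1 - q^b) = multiples b.
quotient : ℕ → ℕ → ℕ → ℕ → Series
quotient a₁ a₂ b₁ b₂ = (1-q^ a₁) ⊛ ((1-q^ a₂) ⊛ (multiples b₁ ⊛ multiples b₂))

quotient-swap : ∀ a₁ a₂ b₁ b₂ → quotient a₁ a₂ b₁ b₂ ≗ quotient a₂ a₁ b₁ b₂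
quotient-swap a₁ a₂ b₁ b₂ =
  solve 3 (λ x y z → x ⊕ (y ⊕ z) ⊜ y ⊕ (x ⊕ z)) ≗-refl (1-q^ a₁) (1-q^ a₂) (multiples b₁ ⊛ multiples b₂)

isExpansion-swap : ∀ {a₁ a₂ b₁ b₂ P} → IsExpansion a₁ a₂ b₁ b₂ P → IsExpansion a₂ a₁ b₁ b₂ P
isExpansion-swap {a₁} {a₂} expansion n = trans (expansion n) (⊛-comm (qint a₁) (qint a₂) n)

module _ {b₁ b₂} (1≤b₁ : 1 ≤ b₁) (1≤b₂ : 1 ≤ b₂) where

  1-q^²-⊛-multiples² : ∀ X → ((1-q^ b₁) ⊛ (1-q^ b₂)) ⊛ ((multiples b₁ ⊛ multiples b₂) ⊛ X) ≗ X
  1-q^²-⊛-multiples² X = begin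
    ((1-q^ b₁) ⊛ (1-q^ b₂)) ⊛ ((multiples b₁ ⊛ multiples b₂) ⊛ X)
      ≈⟨ solve 5 (λ d₁ d₂ m₁ m₂ x → (d₁ ⊕ d₂) ⊕ ((m₁ ⊕ m₂) ⊕ x) ⊜ (d₁ ⊕ m₁) ⊕ ((d₂ ⊕ m₂) ⊕ x))
               ≗-refl (1-q^ b₁) (1-q^ b₂) (multiples b₁) (multiples b₂) X ⟩
    ((1-q^ b₁) ⊛ multiples b₁) ⊛ (((1-q^ b₂) ⊛ multiples b₂) ⊛ X)
      ≈⟨ ⊛-cong (1-q^-⊛-multiples 1≤b₁) (⊛-congˡ X (1-q^-⊛-multiples 1≤b₂)) ⟩
    1ₛ ⊛ (1ₛ ⊛ X)  ≈⟨ ⊛-identityˡ (1ₛ ⊛ X) ⟩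
    1ₛ ⊛ X         ≈⟨ ⊛-identityˡ X ⟩
    X              ∎
    where open ≗-Reasoning

  isExpansion⇒≗quotient : ∀ {a₁ a₂ P} → IsExpansion a₁ a₂ b₁ b₂ P → P ≗ quotient a₁ a₂ b₁ b₂
  isExpansion⇒≗quotient {a₁} {a₂} {P} expansion = begin
    P
      ≈⟨ 1-q^²-⊛-multiples² P ⟨
    ((1-q^ b₁) ⊛ (1-q^ b₂)) ⊛ ((multiples b₁ ⊛ multiples b₂) ⊛ P)
      ≈⟨ solve 5 (λ d₁ d₂ m₁ m₂ x → (d₁ ⊕ d₂) ⊕ ((m₁ ⊕ m₂) ⊕ x) ⊜ (m₁ ⊕ m₂) ⊕ (d₁ ⊕ (d₂ ⊕ x)))
               ≗-refl (1-q^ b₁) (1-q^ b₂) (multiples b₁) (multiples b₂) P ⟩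
    (multiples b₁ ⊛ multiples b₂) ⊛ ((1-q^ b₁) ⊛ ((1-q^ b₂) ⊛ P))
      ≈⟨ ⊛-congʳ (multiples b₁ ⊛ multiples b₂)
                 (Equivalence.to (isExpansion⇔cleared {a₁} {a₂} {b₁} {b₂} {P}) expansion) ⟩
    (multiples b₁ ⊛ multiples b₂) ⊛ ((1-q^ a₁) ⊛ (1-q^ a₂))
      ≈⟨ solve 3 (λ m x y → m ⊕ (x ⊕ y) ⊜ x ⊕ (y ⊕ m))
               ≗-refl (multiples b₁ ⊛ multiples b₂) (1-q^ a₁) (1-q^ a₂) ⟩
    quotient a₁ a₂ b₁ b₂ ∎
    where open ≗-Reasoning

  quotient-isExpansion : ∀ a₁ a₂ → IsExpansion a₁ a₂ b₁ b₂ (quotient a₁ a₂ b₁ b₂)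
  quotient-isExpansion a₁ a₂ =
    Equivalence.from (isExpansion⇔cleared {a₁} {a₂} {b₁} {b₂} {quotient a₁ a₂ b₁ b₂}) (begin
    (1-q^ b₁) ⊛ ((1-q^ b₂) ⊛ quotient a₁ a₂ b₁ b₂)
      ≈⟨ solve 5 (λ d₁ d₂ x y m → d₁ ⊕ (d₂ ⊕ (x ⊕ (y ⊕ m))) ⊜ (d₁ ⊕ d₂) ⊕ (m ⊕ (x ⊕ y)))
               ≗-refl (1-q^ b₁) (1-q^ b₂) (1-q^ a₁) (1-q^ a₂) (multiples b₁ ⊛ multiples b₂) ⟩
    ((1-q^ b₁) ⊛ (1-q^ b₂)) ⊛ ((multiples b₁ ⊛ multiples b₂) ⊛ ((1-q^ a₁) ⊛ (1-q^ a₂)))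
      ≈⟨ 1-q^²-⊛-multiples² ((1-q^ a₁) ⊛ (1-q^ a₂)) ⟩
    (1-q^ a₁) ⊛ (1-q^ a₂) ∎)
    where open ≗-Reasoning

0≤-+ : ∀ {a b} → + 0 ℤ.≤ a → + 0 ℤ.≤ b → + 0 ℤ.≤ a + b
0≤-+ {+ m} {+ n} _ _ = ℤ.+≤+ z≤n

0≤-* : ∀ {a b} → + 0 ℤ.≤ a → + 0 ℤ.≤ b → + 0 ℤ.≤ a * b
0≤-* {+ m} {+ n} _ _ = subst (+ 0 ℤ.≤_) (ℤ.pos-* m n) (ℤ.+≤+ z≤n)

0<1+ : ∀ {a} → + 0 ℤ.≤ a → + 0 ℤ.< + 1 + a
0<1+ {+ n} _ = ℤ.+<+ (s≤s z≤n)

sumTo-nonneg : ∀ {f} → Nonneg f → ∀ n → + 0 ℤ.≤ sumTo f n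
sumTo-nonneg f≥0 zero    = f≥0 0
sumTo-nonneg f≥0 (suc n) = 0≤-+ (sumTo-nonneg f≥0 n) (f≥0 (suc n))

⊛-nonneg : ∀ {f g} → Nonneg f → Nonneg g → Nonneg (f ⊛ g)
⊛-nonneg f≥0 g≥0 n = sumTo-nonneg (λ k → 0≤-* (f≥0 k) (g≥0 (n ∸ k))) n

nonneg-resp-≗ : ∀ {f g} → f ≗ g → Nonneg f → Nonneg g
nonneg-resp-≗ f≗g f≥0 n = subst (+ 0 ℤ.≤_) (f≗g n) (f≥0 n)

q^-nonneg : ∀ m → Nonneg (q^ m)
q^-nonneg m n = isIndicator-nonneg (q^-isIndicator m n)

multiplesBelow-nonneg : ∀ m k → Nonneg (multiplesBelow m k)
multiplesBelow-nonneg m zero    n = ℤ.≤-refl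
multiplesBelow-nonneg m (suc k) n = 0≤-+ (multiplesBelow-nonneg m k n) (q^-nonneg (k ℕ.* m) n)

shift-nonneg : ∀ m {X} → Nonneg X → Nonneg (shift m X)
shift-nonneg zero    X≥0 n       = X≥0 n
shift-nonneg (suc m) X≥0 zero    = ℤ.≤-refl
shift-nonneg (suc m) X≥0 (suc n) = shift-nonneg m X≥0 n

VanishesFrom : ℕ → Series → Set
VanishesFrom d P = ∀ n → d ≤ n → P n ≡ + 0

⊛-vanishesFrom : ∀ {f g A B} → VanishesFrom A f → VanishesFrom B g → VanishesFrom (A ℕ.+ B) (f ⊛ g)
⊛-vanishesFrom {f} {g} {A} {B} f≡0 g≡0 n A+B≤n = trans (sumTo-cong n term≡0) (sumTo-zero n)
  where
  term≡0 : ∀ k → k ≤ n → f k * g (n ∸ k) ≡ + 0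
  term≡0 k k≤n with ℕ.≤-<-connex A k
  ... | inj₁ A≤k = cong (_* g (n ∸ k)) (f≡0 k A≤k)
  ... | inj₂ k<A = trans (cong (f k *_) (g≡0 (n ∸ k) B≤n∸k)) (ℤ.*-zeroʳ (f k))
    where
    B≤n∸k : B ≤ n ∸ k
    B≤n∸k = ℕ.m+n≤o⇒m≤o∸n B (ℕ.≤-trans (ℕ.+-monoʳ-≤ B (ℕ.<⇒≤ k<A))
                                        (subst (_≤ n) (ℕ.+-comm A B) A+B≤n))

⊛-finiteSupport : ∀ {f g} → FiniteSupport f → FiniteSupport g → FiniteSupport (f ⊛ g)
⊛-finiteSupport (A , f≡0) (B , g≡0) = A ℕ.+ B , ⊛-vanishesFrom f≡0 g≡0

+ₛ-finiteSupport : ∀ {f g} → FiniteSupport f → FiniteSupport g → FiniteSupport (f +ₛ g)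
+ₛ-finiteSupport (A , f≡0) (B , g≡0) =
  A ℕ.+ B , λ n A+B≤n → cong₂ _+_ (f≡0 n (ℕ.m+n≤o⇒m≤o A A+B≤n)) (g≡0 n (ℕ.m+n≤o⇒n≤o A A+B≤n))

q^-finiteSupport : ∀ m → FiniteSupport (q^ m)
q^-finiteSupport m = suc m , λ n m<n → isIndicator-no (q^-isIndicator m n) (λ { refl → ℕ.n≮n m m<n })

multiplesBelow-finiteSupport : ∀ m k → FiniteSupport (multiplesBelow m k)
multiplesBelow-finiteSupport m zero    = 0 , λ _ _ → refl
multiplesBelow-finiteSupport m (suc k) =
  +ₛ-finiteSupport (multiplesBelow-finiteSupport m k) (q^-finiteSupport (k ℕ.* m))

finiteSupport-resp-≗ : ∀ {f g} → f ≗ g → FiniteSupport f → FiniteSupport g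
finiteSupport-resp-≗ f≗g (A , f≡0) = A , λ n A≤n → trans (sym (f≗g n)) (f≡0 n A≤n)

-- Necessity of the span condition

sumTo-positive : ∀ f n → + 0 ℤ.< sumTo f n → ∃[ k ] (k ≤ n × + 0 ℤ.< f k)
sumTo-positive f zero    0<f0 = 0 , z≤n , 0<f0
sumTo-positive f (suc n) 0<Σ with + 0 ℤ.<? f (suc n)
... | yes 0<fn = suc n , ℕ.≤-refl , 0<fn
... | no  0≮fn = let (k , k≤n , 0<fk) = sumTo-positive f n 0<Σf in k , ℕ.m≤n⇒m≤1+n k≤n , 0<fk
  where
  0<Σf : + 0 ℤ.< sumTo f n
  0<Σf = ℤ.<-≤-trans 0<Σ (ℤ.≤-trans (ℤ.+-monoʳ-≤ (sumTo f n) (ℤ.≮⇒≥ 0≮fn))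
                                     (ℤ.≤-reflexive (ℤ.+-identityʳ (sumTo f n))))

isIndicator-*-positive : ∀ {A B z w} → IsIndicator A z → IsIndicator B w → + 0 ℤ.< z * w → A × B
isIndicator-*-positive (inj₁ (a , _))    (inj₁ (b , _))    _   = a , b
isIndicator-*-positive {z = z} _ (inj₂ (_ , refl)) 0<z*0 =
  ⊥-elim (ℤ.<-irrefl refl (subst (+ 0 ℤ.<_) (ℤ.*-zeroʳ z) 0<z*0))
isIndicator-*-positive (inj₂ (_ , refl)) _ 0<0 = ⊥-elim (ℤ.<-irrefl refl 0<0)

multiples-⊛-positive⇒inSpan : ∀ b₁ b₂ n → + 0 ℤ.< (multiples b₁ ⊛ multiples b₂) n → InSpan n b₁ b₂
multiples-⊛-positive⇒inSpan b₁ b₂ n 0<N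
  with sumTo-positive (λ k → multiples b₁ k * multiples b₂ (n ∸ k)) n 0<N
... | k , k≤n , 0<term
  with isIndicator-*-positive (multiples-isIndicator b₁ k) (multiples-isIndicator b₂ (n ∸ k)) 0<term
... | divides x k≡x*b₁ , divides y n∸k≡y*b₂ =
  x , y , trans (sym (ℕ.m+[n∸m]≡n k≤n)) (cong₂ ℕ._+_ k≡x*b₁ n∸k≡y*b₂)

-- With N = multiples b₁ ⊛ multiples b₂ counting representations x b₁ + y b₂, the coefficient
-- of q^a₁ in the expansion is N a₁ - shift a₂ N a₁ - 1, and shift a₂ N a₁ ≥ 0.
nonneg-expansion⇒inSpan : ∀ {a₁ a₂ b₁ b₂ P} → 1 ≤ a₂ → 1 ≤ b₁ → 1 ≤ b₂ →
  IsExpansion a₁ a₂ b₁ b₂ P → Nonneg P → InSpan a₁ b₁ b₂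
nonneg-expansion⇒inSpan {a₁} {a₂} {b₁} {b₂} {P} 1≤a₂ 1≤b₁ 1≤b₂ expansion P≥0 =
  multiples-⊛-positive⇒inSpan b₁ b₂ a₁ 0<Na₁
  where
  N Y : Series
  N = multiples b₁ ⊛ multiples b₂
  Y = (1-q^ a₂) ⊛ N
  N0≡1 : N 0 ≡ + 1
  N0≡1 = cong₂ _*_ (isIndicator-yes (multiples-isIndicator b₁ 0) (b₁ ∣0))
                   (isIndicator-yes (multiples-isIndicator b₂ 0) (b₂ ∣0))
  Pa₁≡ : P a₁ ≡ (N a₁ - shift a₂ N a₁) - + 1
  Pa₁≡ = begin
    P a₁                          ≡⟨ isExpansion⇒≗quotient 1≤b₁ 1≤b₂ {a₁} {a₂} {P} expansion a₁ ⟩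
    ((1-q^ a₁) ⊛ Y) a₁            ≡⟨ 1-q^-⊛ a₁ Y a₁ ⟩
    Y a₁ - shift a₁ Y a₁          ≡⟨ cong (λ x → Y a₁ - shift a₁ Y x) (ℕ.+-identityʳ a₁) ⟨
    Y a₁ - shift a₁ Y (a₁ ℕ.+ 0)  ≡⟨ cong (λ x → Y a₁ - x) (shift-+ a₁ Y 0) ⟩
    Y a₁ - Y 0                    ≡⟨ cong₂ _-_ (1-q^-⊛ a₂ N a₁)
                                               (trans (1-q^-⊛ a₂ N 0) (cong₂ _-_ N0≡1 (shift-< a₂ N 1≤a₂))) ⟩
    (N a₁ - shift a₂ N a₁) - + 1  ∎
    where open ≡-Reasoning
  rearrange : ∀ n s → n ≡ + 1 + (((n - s) - + 1) + s)
  rearrange = solve-∀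
  0<Na₁ : + 0 ℤ.< N a₁
  0<Na₁ = subst (+ 0 ℤ.<_) (sym (rearrange (N a₁) (shift a₂ N a₁)))
            (0<1+ (0≤-+ (subst (+ 0 ℤ.≤_) Pa₁≡ (P≥0 a₁))
                        (shift-nonneg a₂ (⊛-nonneg (multiples-nonneg b₁) (multiples-nonneg b₂)) a₁)))

-- Necessity of the divisibility conditions

sumBelow : ℕ → (ℕ → ℤ) → ℤ
sumBelow zero    t = + 0
sumBelow (suc B) t = sumBelow B t + t B

sumBelow-cong : ∀ {t u} B → (∀ n → n < B → t n ≡ u n) → sumBelow B t ≡ sumBelow B u
sumBelow-cong zero    t≡u = refl
sumBelow-cong (suc B) t≡u =
  cong₂ _+_ (sumBelow-cong B (λ n n<B → t≡u n (ℕ.m≤n⇒m≤1+n n<B))) (t≡u B ℕ.≤-refl)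

sumBelow-zero : ∀ B → sumBelow B (λ _ → + 0) ≡ + 0
sumBelow-zero zero    = refl
sumBelow-zero (suc B) = cong (_+ + 0) (sumBelow-zero B)

sumBelow-sub : ∀ t u B → sumBelow B (λ n → t n - u n) ≡ sumBelow B t - sumBelow B u
sumBelow-sub t u zero    = refl
sumBelow-sub t u (suc B) =
  trans (cong (_+ (t B - u B)) (sumBelow-sub t u B))
        (interchange (sumBelow B t) (sumBelow B u) (t B) (u B))
  where
  interchange : ∀ a b c d → (a - b) + (c - d) ≡ (a + c) - (b + d)
  interchange = solve-∀

sumBelow-vanishesFrom : ∀ {t S} B → VanishesFrom S t → S ≤ B → sumBelow B t ≡ sumBelow S t
sumBelow-vanishesFrom {t} {S} B t≡0 S≤B with ℕ.m≤n⇒m<n∨m≡n S≤B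
... | inj₂ refl = refl
sumBelow-vanishesFrom {t} {S} (suc B) t≡0 _ | inj₁ (s≤s S≤B) =
  trans (cong₂ _+_ (sumBelow-vanishesFrom B t≡0 S≤B) (t≡0 B S≤B)) (ℤ.+-identityʳ (sumBelow S t))

pairing : ℕ → (ℕ → ℤ) → Series → ℤ
pairing B c X = sumBelow B (λ n → c n * X n)

pairing-congʳ : ∀ B c {X Y} → X ≗ Y → pairing B c X ≡ pairing B c Y
pairing-congʳ B c X≗Y = sumBelow-cong B (λ n _ → cong (c n *_) (X≗Y n))

pairing-zeroˡ : ∀ B {c} X → (∀ n → c n ≡ + 0) → pairing B c X ≡ + 0
pairing-zeroˡ B {c} X c≡0 =
  trans (sumBelow-cong B (λ n _ → trans (cong (_* X n) (c≡0 n)) (ℤ.*-zeroˡ (X n)))) (sumBelow-zero B)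

pairing-vanishesFrom : ∀ B c {X S} → VanishesFrom S X → S ≤ B → pairing B c X ≡ pairing S c X
pairing-vanishesFrom B c {X} X≡0 =
  sumBelow-vanishesFrom B (λ n S≤n → trans (cong (c n *_) (X≡0 n S≤n)) (ℤ.*-zeroʳ (c n)))

pairing-shift-+ : ∀ c m X B → pairing (m ℕ.+ B) c (shift m X) ≡ pairing B (λ n → c (n ℕ.+ m)) X
pairing-shift-+ c m X zero =
  trans (sumBelow-cong (m ℕ.+ 0) shifted≡0) (sumBelow-zero (m ℕ.+ 0))
  where
  shifted≡0 : ∀ n → n < m ℕ.+ 0 → c n * shift m X n ≡ + 0
  shifted≡0 n n<m+0 =
    trans (cong (c n *_) (shift-< m X (subst (n <_) (ℕ.+-identityʳ m) n<m+0))) (ℤ.*-zeroʳ (c n))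
pairing-shift-+ c m X (suc B) rewrite ℕ.+-suc m B =
  cong₂ _+_ (pairing-shift-+ c m X B) (cong₂ _*_ (cong c (ℕ.+-comm m B)) (shift-+ m X B))

shift-vanishesFrom : ∀ m {X S} → VanishesFrom S X → VanishesFrom (m ℕ.+ S) (shift m X)
shift-vanishesFrom m {X} {S} X≡0 n m+S≤n with shift-view m X n
... | inj₁ (_ , s≡0)        = s≡0
... | inj₂ (k , refl , s≡) = trans s≡ (X≡0 k (ℕ.+-cancelˡ-≤ m S k m+S≤n))

1-q^-⊛-vanishesFrom : ∀ m {X S} → VanishesFrom S X → VanishesFrom (S ℕ.+ m) ((1-q^ m) ⊛ X)
1-q^-⊛-vanishesFrom m {X} {S} X≡0 n S+m≤n =
  trans (1-q^-⊛ m X n)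
        (cong₂ _-_ (X≡0 n (ℕ.m+n≤o⇒m≤o S S+m≤n))
                   (shift-vanishesFrom m X≡0 n (subst (_≤ n) (ℕ.+-comm S m) S+m≤n)))

Δ : ℕ → (ℕ → ℤ) → ℕ → ℤ
Δ m c n = c n - c (n ℕ.+ m)

pairing-1-q^-⊛ : ∀ B c m {X S} → VanishesFrom S X → S ℕ.+ m ≤ B →
  pairing B c ((1-q^ m) ⊛ X) ≡ pairing B (Δ m c) X
pairing-1-q^-⊛ B c m {X} {S} X≡0 S+m≤B = begin
  pairing B c ((1-q^ m) ⊛ X)
    ≡⟨ sumBelow-cong B (λ n _ → trans (cong (c n *_) (1-q^-⊛ m X n))
                                      (*-distribˡ-sub (c n) (X n) (shift m X n))) ⟩
  sumBelow B (λ n → c n * X n - c n * shift m X n)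
    ≡⟨ sumBelow-sub (λ n → c n * X n) (λ n → c n * shift m X n) B ⟩
  pairing B c X - pairing B c (shift m X)
    ≡⟨ cong (λ x → pairing B c X - x) shifted ⟩
  pairing B c X - pairing B (λ n → c (n ℕ.+ m)) X
    ≡⟨ sumBelow-sub (λ n → c n * X n) (λ n → c (n ℕ.+ m) * X n) B ⟨
  sumBelow B (λ n → c n * X n - c (n ℕ.+ m) * X n)
    ≡⟨ sumBelow-cong B (λ n _ → sym (*-distribʳ-sub (c n) (c (n ℕ.+ m)) (X n))) ⟩
  pairing B (Δ m c) X ∎
  where
  open ≡-Reasoning
  *-distribˡ-sub : ∀ a b c → a * (b - c) ≡ a * b - a * c
  *-distribˡ-sub = solve-∀
  *-distribʳ-sub : ∀ a b c → (a - b) * c ≡ a * c - b * c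
  *-distribʳ-sub = solve-∀
  m+S≤B : m ℕ.+ S ≤ B
  m+S≤B = subst (_≤ B) (ℕ.+-comm S m) S+m≤B
  S≤B : S ≤ B
  S≤B = ℕ.m+n≤o⇒m≤o S S+m≤B
  shifted : pairing B c (shift m X) ≡ pairing B (λ n → c (n ℕ.+ m)) X
  shifted = begin
    pairing B c (shift m X)          ≡⟨ pairing-vanishesFrom B c (shift-vanishesFrom m X≡0) m+S≤B ⟩
    pairing (m ℕ.+ S) c (shift m X)  ≡⟨ pairing-shift-+ c m X S ⟩
    pairing S (λ n → c (n ℕ.+ m)) X  ≡⟨ pairing-vanishesFrom B (λ n → c (n ℕ.+ m)) X≡0 S≤B ⟨
    pairing B (λ n → c (n ℕ.+ m)) X  ∎

pairing-1-q^²-⊛ : ∀ B c m₁ m₂ {X S} → VanishesFrom S X → S ℕ.+ m₂ ℕ.+ m₁ ≤ B →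
  pairing B c ((1-q^ m₁) ⊛ ((1-q^ m₂) ⊛ X)) ≡ pairing B (Δ m₂ (Δ m₁ c)) X
pairing-1-q^²-⊛ B c m₁ m₂ {X} {S} X≡0 S+m₂+m₁≤B =
  trans (pairing-1-q^-⊛ B c m₁ (1-q^-⊛-vanishesFrom m₂ X≡0) S+m₂+m₁≤B)
        (pairing-1-q^-⊛ B (Δ m₁ c) m₂ X≡0 (ℕ.m+n≤o⇒m≤o (S ℕ.+ m₂) S+m₂+m₁≤B))

-- Pair both sides of the cleared identity with c over a range beyond both supports.
second-difference-transfer : ∀ {a₁ a₂ b₁ b₂ P} → IsExpansion a₁ a₂ b₁ b₂ P → FiniteSupport P →
  ∀ c → (∀ n → Δ b₂ (Δ b₁ c) n ≡ + 0) → Δ a₂ (Δ a₁ c) 0 ≡ + 0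
second-difference-transfer {a₁} {a₂} {b₁} {b₂} {P} expansion (S , P≡0) c Δ²c≡0 = begin
  Δ a₂ (Δ a₁ c) 0                            ≡⟨ ℤ.*-identityʳ _ ⟨
  Δ a₂ (Δ a₁ c) 0 * 1ₛ 0                     ≡⟨ ℤ.+-identityˡ _ ⟨
  pairing 1 (Δ a₂ (Δ a₁ c)) 1ₛ               ≡⟨ pairing-vanishesFrom B (Δ a₂ (Δ a₁ c)) 1ₛ≡0 (s≤s z≤n) ⟨
  pairing B (Δ a₂ (Δ a₁ c)) 1ₛ               ≡⟨ pairing-1-q^²-⊛ B c a₁ a₂ 1ₛ≡0 (ℕ.m≤m+n _ _) ⟨
  pairing B c ((1-q^ a₁) ⊛ ((1-q^ a₂) ⊛ 1ₛ))  ≡⟨ pairing-congʳ B c cleared ⟩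
  pairing B c ((1-q^ b₁) ⊛ ((1-q^ b₂) ⊛ P))   ≡⟨ pairing-1-q^²-⊛ B c b₁ b₂ P≡0 (ℕ.m≤n+m _ (suc (a₂ ℕ.+ a₁))) ⟩
  pairing B (Δ b₂ (Δ b₁ c)) P                ≡⟨ pairing-zeroˡ B P Δ²c≡0 ⟩
  + 0                                        ∎
  where
  open ≡-Reasoning
  cleared : (1-q^ a₁) ⊛ ((1-q^ a₂) ⊛ 1ₛ) ≗ (1-q^ b₁) ⊛ ((1-q^ b₂) ⊛ P)
  cleared n = trans (⊛-congʳ (1-q^ a₁) (⊛-identityʳ (1-q^ a₂)) n)
                    (sym (Equivalence.to (isExpansion⇔cleared {a₁} {a₂} {b₁} {b₂} {P}) expansion n))
  B : ℕ
  B = 1 ℕ.+ a₂ ℕ.+ a₁ ℕ.+ (S ℕ.+ b₂ ℕ.+ b₁)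
  1ₛ≡0 : VanishesFrom 1 1ₛ
  1ₛ≡0 = proj₂ (q^-finiteSupport 0)

Periodic : ℕ → (ℕ → ℤ) → Set
Periodic p c = ∀ n → c (n ℕ.+ p) ≡ c n

Δ-periodic : ∀ {p c} → Periodic p c → ∀ n → Δ p c n ≡ + 0
Δ-periodic {p} {c} c-periodic n = trans (cong (λ x → c n - x) (c-periodic n)) (ℤ.+-inverseʳ (c n))

Δ-preserves-periodic : ∀ {p c} m → Periodic p c → Periodic p (Δ m c)
Δ-preserves-periodic {p} {c} m c-periodic n =
  cong₂ _-_ (c-periodic n) (trans (cong c (xy∙z≈xz∙y n p m)) (c-periodic (n ℕ.+ m)))

Δ²-periodicˡ : ∀ {p c} m → Periodic p c → ∀ n → Δ m (Δ p c) n ≡ + 0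
Δ²-periodicˡ {p} {c} m c-periodic n =
  cong₂ _-_ (Δ-periodic c-periodic n) (Δ-periodic c-periodic (n ℕ.+ m))

Δ²-periodicʳ : ∀ {p c} m → Periodic p c → ∀ n → Δ p (Δ m c) n ≡ + 0
Δ²-periodicʳ m c-periodic = Δ-periodic (Δ-preserves-periodic m c-periodic)

linear·multiples : ℕ → ℕ → ℤ
linear·multiples g n = + n * multiples g n

Δ-linear·multiples : ∀ {g m} → g ∣ m → ∀ n → Δ m (linear·multiples g) n ≡ - (+ m * multiples g n)
Δ-linear·multiples {g} {m} g∣m n = begin
  + n * multiples g n - + (n ℕ.+ m) * multiples g (n ℕ.+ m)
    ≡⟨ cong₂ (λ x y → + n * multiples g n - x * y) (ℤ.pos-+ n m) (multiples-periodic g∣m n) ⟩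
  + n * multiples g n - (+ n + + m) * multiples g n   ≡⟨ cancel (+ n) (+ m) (multiples g n) ⟩
  - (+ m * multiples g n) ∎
  where
  open ≡-Reasoning
  cancel : ∀ x y z → x * z - (x + y) * z ≡ - (y * z)
  cancel = solve-∀

-- Test weights: multiples d is periodic modulo b₁ or b₂, and n ↦ n [g ∣ n] has a b₁-difference
-- that is periodic modulo b₂.
module _ {a₁ a₂ b₁ b₂ P} (expansion : IsExpansion a₁ a₂ b₁ b₂ P) (finite : FiniteSupport P) where

  private
    transfer : ∀ c → (∀ n → Δ b₂ (Δ b₁ c) n ≡ + 0) → Δ a₂ (Δ a₁ c) 0 ≡ + 0
    transfer = second-difference-transfer {a₁} {a₂} {b₁} {b₂} {P} expansion finite

  divides-denominator⇒divides-numerator : ∀ {d} → d ∣ b₁ ⊎ d ∣ b₂ → d ∣ a₁ ⊎ d ∣ a₂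
  divides-denominator⇒divides-numerator {d} d∣b with d ∣? a₁ | d ∣? a₂
  ... | yes d∣a₁ | _        = inj₁ d∣a₁
  ... | no  _    | yes d∣a₂ = inj₂ d∣a₂
  ... | no  d∤a₁ | no  d∤a₂ = ⊥-elim (ℤ.<-irrefl refl (subst (+ 0 ℤ.<_) Δ²c0≡0 0<Δ²c0))
    where
    c : ℕ → ℤ
    c = multiples d
    Δ²c0≡0 : Δ a₂ (Δ a₁ c) 0 ≡ + 0
    Δ²c0≡0 = transfer c Δ²c≡0
      where
      Δ²c≡0 : ∀ n → Δ b₂ (Δ b₁ c) n ≡ + 0
      Δ²c≡0 = [ (λ d∣b₁ → Δ²-periodicˡ b₂ (multiples-periodic d∣b₁))
              , (λ d∣b₂ → Δ²-periodicʳ b₁ (multiples-periodic d∣b₂)) ]′ d∣b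
    0<Δ²c0 : + 0 ℤ.< Δ a₂ (Δ a₁ c) 0
    0<Δ²c0 rewrite isIndicator-yes (multiples-isIndicator d 0) (d ∣0)
                 | isIndicator-no (multiples-isIndicator d a₁) d∤a₁
                 | isIndicator-no (multiples-isIndicator d a₂) d∤a₂ =
      subst (+ 0 ℤ.<_) (simplify (c (a₂ ℕ.+ a₁))) (0<1+ (multiples-nonneg d (a₂ ℕ.+ a₁)))
      where
      simplify : ∀ x → + 1 + x ≡ (+ 1 - + 0) - (+ 0 - x)
      simplify = solve-∀

  common-divisor-divides-both : 1 ≤ a₁ → ∀ {g} → g ∣ b₁ → g ∣ b₂ → g ∣ a₁ → g ∣ a₂
  common-divisor-divides-both 1≤a₁ {g} g∣b₁ g∣b₂ g∣a₁ with g ∣? a₂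
  ... | yes g∣a₂ = g∣a₂
  ... | no  g∤a₂ = ⊥-elim (ℕ.<⇒≢ 1≤a₁ (sym (ℤ.+-injective (ℤ.neg-injective -a₁≡0))))
    where
    c : ℕ → ℤ
    c = linear·multiples g
    Δ²c≡0 : ∀ n → Δ b₂ (Δ b₁ c) n ≡ + 0
    Δ²c≡0 n = trans (cong₂ _-_ (Δ-linear·multiples g∣b₁ n) (Δ-linear·multiples g∣b₁ (n ℕ.+ b₂)))
                    (Δ-periodic (λ k → cong (λ x → - (+ b₁ * x)) (multiples-periodic g∣b₂ k)) n)
    -a₁≡0 : - + a₁ ≡ + 0
    -a₁≡0 = begin
      - + a₁
        ≡⟨ simplify (+ a₁) ⟨
      - (+ a₁ * + 1) - - (+ a₁ * + 0)
        ≡⟨ cong₂ (λ x y → - (+ a₁ * x) - - (+ a₁ * y))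
                 (isIndicator-yes (multiples-isIndicator g 0) (g ∣0))
                 (isIndicator-no (multiples-isIndicator g a₂) g∤a₂) ⟨
      - (+ a₁ * multiples g 0) - - (+ a₁ * multiples g a₂)
        ≡⟨ cong₂ _-_ (Δ-linear·multiples g∣a₁ 0) (Δ-linear·multiples g∣a₁ a₂) ⟨
      Δ a₂ (Δ a₁ c) 0
        ≡⟨ transfer c Δ²c≡0 ⟩
      + 0 ∎
      where
      open ≡-Reasoning
      simplify : ∀ x → - (x * + 1) - - (x * + 0) ≡ - x
      simplify = solve-∀

divCond-cases : ∀ {a₁ a₂ b₁ b₂} → b₁ ∣ a₁ ⊎ b₁ ∣ a₂ → b₂ ∣ a₁ ⊎ b₂ ∣ a₂ →
  gcd b₁ b₂ ∣ a₁ × gcd b₁ b₂ ∣ a₂ → DivCond a₁ a₂ b₁ b₂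
divCond-cases (inj₁ b₁∣a₁) (inj₂ b₂∣a₂) _             = inj₁ (b₁∣a₁ , b₂∣a₂)
divCond-cases (inj₂ b₁∣a₂) (inj₁ b₂∣a₁) _             = inj₂ (inj₁ (b₁∣a₂ , b₂∣a₁))
divCond-cases (inj₁ b₁∣a₁) (inj₁ b₂∣a₁) (_ , g∣a₂)    = inj₂ (inj₂ (inj₁ (b₁∣a₁ , b₂∣a₁ , g∣a₂)))
divCond-cases (inj₂ b₁∣a₂) (inj₂ b₂∣a₂) (g∣a₁ , _)    = inj₂ (inj₂ (inj₂ (b₁∣a₂ , b₂∣a₂ , g∣a₁)))

polynomial⇒divCond : ∀ {a₁ a₂ b₁ b₂} → 1 ≤ a₁ → 1 ≤ a₂ → IsPolynomial a₁ a₂ b₁ b₂ → DivCond a₁ a₂ b₁ b₂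
polynomial⇒divCond {a₁} {a₂} {b₁} {b₂} 1≤a₁ 1≤a₂ (P , expansion , finite) =
  divCond-cases (divides-numerator (inj₁ ∣-refl)) (divides-numerator (inj₂ ∣-refl)) gcd∣a
  where
  divides-numerator : ∀ {d} → d ∣ b₁ ⊎ d ∣ b₂ → d ∣ a₁ ⊎ d ∣ a₂
  divides-numerator = divides-denominator⇒divides-numerator {P = P} expansion finite
  g∣b₁ : gcd b₁ b₂ ∣ b₁
  g∣b₁ = gcd[m,n]∣m b₁ b₂
  g∣b₂ : gcd b₁ b₂ ∣ b₂
  g∣b₂ = gcd[m,n]∣n b₁ b₂
  gcd∣a : gcd b₁ b₂ ∣ a₁ × gcd b₁ b₂ ∣ a₂
  gcd∣a with divides-numerator (inj₁ g∣b₁)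
  ... | inj₁ g∣a₁ = g∣a₁ , common-divisor-divides-both {P = P} expansion finite 1≤a₁ g∣b₁ g∣b₂ g∣a₁
  ... | inj₂ g∣a₂ = common-divisor-divides-both {P = P} swapped finite 1≤a₂ g∣b₁ g∣b₂ g∣a₂ , g∣a₂
    where
    swapped : IsExpansion a₂ a₁ b₁ b₂ P
    swapped = isExpansion-swap {a₁} {a₂} {b₁} {b₂} {P} expansion

-- Sylvester's theorem for two generators

inSpan-swap : ∀ {n b₁ b₂} → InSpan n b₁ b₂ → InSpan n b₂ b₁
inSpan-swap {b₁ = b₁} {b₂} (x , y , n≡) = y , x , trans n≡ (ℕ.+-comm (x ℕ.* b₁) (y ℕ.* b₂))

inSpan-+ : ∀ {m n b₁ b₂} → InSpan m b₁ b₂ → InSpan n b₁ b₂ → InSpan (m ℕ.+ n) b₁ b₂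
inSpan-+ {b₁ = b₁} {b₂} (x , y , refl) (x′ , y′ , refl) = x ℕ.+ x′ , y ℕ.+ y′ , ℕ-solve x y x′ y′ b₁ b₂
  where
  ℕ-solve : ∀ x y x′ y′ b₁ b₂ → x ℕ.* b₁ ℕ.+ y ℕ.* b₂ ℕ.+ (x′ ℕ.* b₁ ℕ.+ y′ ℕ.* b₂)
                                ≡ (x ℕ.+ x′) ℕ.* b₁ ℕ.+ (y ℕ.+ y′) ℕ.* b₂
  ℕ-solve = ℕ-solve-∀

m+n≡o+p⇒o≡m+[n∸p] : ∀ {m n o p} → m ℕ.+ n ≡ o ℕ.+ p → m ≤ o → o ≡ m ℕ.+ (n ∸ p)
m+n≡o+p⇒o≡m+[n∸p] {m} {n} {o} {p} eq m≤o = sym (trans (cong (m ℕ.+_) n∸p≡o∸m) (ℕ.m+[n∸m]≡n m≤o))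
  where
  open ≡-Reasoning
  n∸p≡o∸m : n ∸ p ≡ o ∸ m
  n∸p≡o∸m = begin
    n ∸ p                  ≡⟨ ℕ.[m+n]∸[m+o]≡n∸o m n p ⟨
    (m ℕ.+ n) ∸ (m ℕ.+ p)  ≡⟨ cong₂ _∸_ eq (ℕ.+-comm m p) ⟩
    (o ℕ.+ p) ∸ (p ℕ.+ m)  ≡⟨ cong (_∸ (p ℕ.+ m)) (ℕ.+-comm o p) ⟩
    (p ℕ.+ o) ∸ (p ℕ.+ m)  ≡⟨ ℕ.[m+n]∸[m+o]≡n∸o p o m ⟩
    o ∸ m                  ∎

-- Reduce the coefficient m x of b₁ in m (g + y b₂) = m x b₁ modulo c, moving multiples of the
-- common multiple c b₁ = e b₂ onto b₂.
bézout⇒large-multiple-inSpan : ∀ {b₁ b₂ g x y c e} .{{_ : NonZero c}} →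
  g ℕ.+ y ℕ.* b₂ ≡ x ℕ.* b₁ → c ℕ.* b₁ ≡ e ℕ.* b₂ →
  ∀ m → c ℕ.* b₁ ≤ m ℕ.* g → InSpan (m ℕ.* g) b₁ b₂
bézout⇒large-multiple-inSpan {b₁} {b₂} {g} {x} {y} {c} {e} bézout common m c*b₁≤n =
  i , t ℕ.* e ∸ m ℕ.* y ,
  trans (m+n≡o+p⇒o≡m+[n∸p] key i*b₁≤n)
        (cong (i ℕ.* b₁ ℕ.+_) (sym (ℕ.*-distribʳ-∸ b₂ (t ℕ.* e) (m ℕ.* y))))
  where
  i t : ℕ
  i = (m ℕ.* x) % c
  t = (m ℕ.* x) / c
  i*b₁≤n : i ℕ.* b₁ ≤ m ℕ.* g
  i*b₁≤n = ℕ.≤-trans (ℕ.*-monoˡ-≤ b₁ (ℕ.<⇒≤ (m%n<n (m ℕ.* x) c))) c*b₁≤n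
  key : i ℕ.* b₁ ℕ.+ t ℕ.* e ℕ.* b₂ ≡ m ℕ.* g ℕ.+ m ℕ.* y ℕ.* b₂
  key = begin
    i ℕ.* b₁ ℕ.+ t ℕ.* e ℕ.* b₂
      ≡⟨ cong (i ℕ.* b₁ ℕ.+_) (trans (ℕ.*-assoc t e b₂) (cong (t ℕ.*_) (sym common))) ⟩
    i ℕ.* b₁ ℕ.+ t ℕ.* (c ℕ.* b₁)    ≡⟨ ℕ-solve₁ i t c b₁ ⟩
    (i ℕ.+ t ℕ.* c) ℕ.* b₁           ≡⟨ cong (ℕ._* b₁) (m≡m%n+[m/n]*n (m ℕ.* x) c) ⟨
    m ℕ.* x ℕ.* b₁                   ≡⟨ trans (ℕ.*-assoc m x b₁) (cong (m ℕ.*_) (sym bézout)) ⟩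
    m ℕ.* (g ℕ.+ y ℕ.* b₂)           ≡⟨ ℕ-solve₂ m g y b₂ ⟩
    m ℕ.* g ℕ.+ m ℕ.* y ℕ.* b₂       ∎
    where
    open ≡-Reasoning
    ℕ-solve₁ : ∀ i t c b → i ℕ.* b ℕ.+ t ℕ.* (c ℕ.* b) ≡ (i ℕ.+ t ℕ.* c) ℕ.* b
    ℕ-solve₁ = ℕ-solve-∀
    ℕ-solve₂ : ∀ m g y b → m ℕ.* (g ℕ.+ y ℕ.* b) ≡ m ℕ.* g ℕ.+ m ℕ.* y ℕ.* b
    ℕ-solve₂ = ℕ-solve-∀

lcm-nonZero : ∀ {b₁ b₂} → 1 ≤ b₁ → 1 ≤ b₂ → NonZero (lcm b₁ b₂)
lcm-nonZero {b₁} {b₂} 1≤b₁ 1≤b₂ = ℕ.≢-nonZero lcm≢0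
  where
  lcm≢0 : lcm b₁ b₂ ≢ 0
  lcm≢0 lcm≡0 = ℕ.<⇒≢ (ℕ.*-mono-≤ 1≤b₁ 1≤b₂)
    (sym (trans (sym (gcd*lcm b₁ b₂)) (trans (cong (gcd b₁ b₂ ℕ.*_) lcm≡0) (ℕ.*-zeroʳ (gcd b₁ b₂)))))

nonZero-factor : ∀ {l c b} → .{{NonZero l}} → l ≡ c ℕ.* b → NonZero c
nonZero-factor {c = c} {{l≢0}} refl = ℕ.m*n≢0⇒m≢0 c {{l≢0}}

large-multiple-of-gcd⇒inSpan : ∀ {b₁ b₂} → 1 ≤ b₁ → 1 ≤ b₂ →
  ∀ {n} → gcd b₁ b₂ ∣ n → lcm b₁ b₂ ≤ n → InSpan n b₁ b₂
large-multiple-of-gcd⇒inSpan {b₁} {b₂} 1≤b₁ 1≤b₂ (divides m refl) lcm≤n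
  with Bézout.identity (gcd-GCD b₁ b₂) | m∣lcm[m,n] b₁ b₂ | n∣lcm[m,n] b₁ b₂
... | Bézout.+- x y bézout | divides c l≡c*b₁ | divides e l≡e*b₂ =
  bézout⇒large-multiple-inSpan {b₁} {b₂} {gcd b₁ b₂} {x} {y} {c} {e}
    {{nonZero-factor {{lcm-nonZero 1≤b₁ 1≤b₂}} l≡c*b₁}}
    bézout (trans (sym l≡c*b₁) l≡e*b₂) m (subst (_≤ m ℕ.* gcd b₁ b₂) l≡c*b₁ lcm≤n)
... | Bézout.-+ x y bézout | divides c l≡c*b₁ | divides e l≡e*b₂ =
  inSpan-swap (bézout⇒large-multiple-inSpan {b₂} {b₁} {gcd b₁ b₂} {y} {x} {e} {c}
    {{nonZero-factor {{lcm-nonZero 1≤b₁ 1≤b₂}} l≡e*b₂}}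
    bézout (trans (sym l≡e*b₂) l≡c*b₁) m (subst (_≤ m ℕ.* gcd b₁ b₂) l≡e*b₂ lcm≤n))

inSpan⇒gcd∣ : ∀ {n b₁ b₂} → InSpan n b₁ b₂ → gcd b₁ b₂ ∣ n
inSpan⇒gcd∣ {b₁ = b₁} {b₂} (x , y , refl) =
  ∣m∣n⇒∣m+n (∣-trans (gcd[m,n]∣m b₁ b₂) (n∣m*n x)) (∣-trans (gcd[m,n]∣n b₁ b₂) (n∣m*n y))

-- The indicator series of the semigroup generated by b₁ and b₂

sumBelow-isIndicator : ∀ {R : ℕ → Set} {t} k → (∀ i → IsIndicator (R i) (t i)) →
  (∀ {i j} → i < k → j < k → R i → R j → i ≡ j) → IsIndicator (∃[ i ] (i < k × R i)) (sumBelow k t)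
sumBelow-isIndicator zero    t-ind unique = inj₂ ((λ { (_ , () , _) }) , refl)
sumBelow-isIndicator {R} {t} (suc k) t-ind unique
  with sumBelow-isIndicator k t-ind (λ i<k j<k → unique (ℕ.m≤n⇒m≤1+n i<k) (ℕ.m≤n⇒m≤1+n j<k))
     | t-ind k
... | inj₁ ((i , i<k , Ri) , Σ≡1) | inj₁ (Rk , _) =
  ⊥-elim (ℕ.<⇒≢ i<k (unique (ℕ.m≤n⇒m≤1+n i<k) ℕ.≤-refl Ri Rk))
... | inj₁ ((i , i<k , Ri) , Σ≡1) | inj₂ (_ , tk≡0) =
  inj₁ ((i , ℕ.m≤n⇒m≤1+n i<k , Ri) , cong₂ _+_ Σ≡1 tk≡0)
... | inj₂ (_ , Σ≡0) | inj₁ (Rk , tk≡1) = inj₁ ((k , ℕ.≤-refl , Rk) , cong₂ _+_ Σ≡0 tk≡1)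
... | inj₂ (none , Σ≡0) | inj₂ (¬Rk , tk≡0) = inj₂ (none′ , cong₂ _+_ Σ≡0 tk≡0)
  where
  none′ : ¬ (∃[ i ] (i < suc k × R i))
  none′ (i , s≤s i≤k , Ri) with ℕ.m≤n⇒m<n∨m≡n i≤k
  ... | inj₁ i<k  = none (i , i<k , Ri)
  ... | inj₂ refl = ¬Rk Ri

multiplesBelow-⊛ : ∀ m k X n → (multiplesBelow m k ⊛ X) n ≡ sumBelow k (λ i → shift (i ℕ.* m) X n)
multiplesBelow-⊛ m zero    X n = ⊛-zeroˡ X n
multiplesBelow-⊛ m (suc k) X n =
  trans (⊛-distribʳ-+ₛ (multiplesBelow m k) (q^ (k ℕ.* m)) X n)
        (cong₂ _+_ (multiplesBelow-⊛ m k X n) (q^-⊛ (k ℕ.* m) X n))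

shift-multiples-isIndicator : ∀ s d n → IsIndicator (∃[ y ] n ≡ s ℕ.+ y ℕ.* d) (shift s (multiples d) n)
shift-multiples-isIndicator s d n with shift-view s (multiples d) n
... | inj₁ (n<s , x≡0) = inj₂ ((λ { (y , refl) → ℕ.<⇒≱ n<s (ℕ.m≤m+n s (y ℕ.* d)) }) , x≡0)
... | inj₂ (k , refl , x≡) =
  isIndicator-resp (λ { (divides y k≡y*d) → y , cong (s ℕ.+_) k≡y*d })
                   (λ { (y , s+k≡s+y*d) → divides y (ℕ.+-cancelˡ-≡ s k _ s+k≡s+y*d) })
                   (subst (IsIndicator (d ∣ k)) (sym x≡) (multiples-isIndicator d k))

1-q^-⊛-indicator-nonneg : ∀ {S : ℕ → Set} {X} a → (∀ n → IsIndicator (S n) (X n)) →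
  (∀ k → S k → S (a ℕ.+ k)) → Nonneg ((1-q^ a) ⊛ X)
1-q^-⊛-indicator-nonneg {S} {X} a X-ind a+S⊆S n with shift-view a X n
... | inj₁ (_ , s≡0) =
  subst (+ 0 ℤ.≤_) (sym (trans (1-q^-⊛ a X n) (trans (cong (λ x → X n - x) s≡0) (ℤ.+-identityʳ (X n)))))
        (isIndicator-nonneg (X-ind n))
... | inj₂ (k , refl , s≡) =
  subst (+ 0 ℤ.≤_) (sym (trans (1-q^-⊛ a X (a ℕ.+ k)) (cong (λ x → X (a ℕ.+ k) - x) s≡)))
        (ℤ.i≤j⇒0≤j-i (isIndicator-mono (a+S⊆S k) (X-ind k) (X-ind (a ℕ.+ k))))

1-q^-⊛-vanishesFrom-periodic : ∀ {X L} p → (∀ n → L ≤ n → X (n ℕ.+ p) ≡ X n) →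
  VanishesFrom (L ℕ.+ p) ((1-q^ p) ⊛ X)
1-q^-⊛-vanishesFrom-periodic {X} {L} p X-periodic n L+p≤n with shift-view p X n
... | inj₁ (n<p , _) = ⊥-elim (ℕ.<⇒≱ n<p (ℕ.m+n≤o⇒n≤o L L+p≤n))
... | inj₂ (k , refl , s≡) =
  trans (1-q^-⊛ p X (p ℕ.+ k))
        (trans (cong₂ _-_ (trans (cong X (ℕ.+-comm p k)) (X-periodic k L≤k)) s≡) (ℤ.+-inverseʳ (X k)))
  where
  L≤k : L ≤ k
  L≤k = ℕ.+-cancelʳ-≤ p L k (subst (L ℕ.+ p ≤_) (ℕ.+-comm p k) L+p≤n)

-- With c b₁ = lcm(b₁, b₂), spanIndicator = (1 - q^lcm)/((1 - q^b₁)(1 - q^b₂)) counts the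
-- representations i b₁ + y b₂ with i < c, and each element of the span has exactly one.
module SpanIndicator {b₁ b₂} (1≤b₁ : 1 ≤ b₁) (1≤b₂ : 1 ≤ b₂) where

  private
    instance
      b₁≢0 : NonZero b₁
      b₁≢0 = ℕ.>-nonZero 1≤b₁

  c : ℕ
  c = _∣_.quotient (m∣lcm[m,n] b₁ b₂)

  lcm≡c*b₁ : lcm b₁ b₂ ≡ c ℕ.* b₁
  lcm≡c*b₁ = _∣_.equality (m∣lcm[m,n] b₁ b₂)

  spanIndicator : Series
  spanIndicator = multiplesBelow b₁ c ⊛ multiples b₂

  1-q^lcm-⊛-multiples² : (1-q^ lcm b₁ b₂) ⊛ (multiples b₁ ⊛ multiples b₂) ≗ spanIndicator
  1-q^lcm-⊛-multiples² = begin
    (1-q^ lcm b₁ b₂) ⊛ (multiples b₁ ⊛ multiples b₂)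
      ≈⟨ ⊛-assoc (1-q^ lcm b₁ b₂) (multiples b₁) (multiples b₂) ⟨
    ((1-q^ lcm b₁ b₂) ⊛ multiples b₁) ⊛ multiples b₂
      ≈⟨ ⊛-congˡ (multiples b₂) (λ n → trans (cong (λ l → ((1-q^ l) ⊛ multiples b₁) n) lcm≡c*b₁)
                                            (1-q^-multiple-⊛-multiples 1≤b₁ c n)) ⟩
    spanIndicator ∎
    where open ≗-Reasoning

  Representation : ℕ → ℕ → Set
  Representation n i = ∃[ y ] n ≡ i ℕ.* b₁ ℕ.+ y ℕ.* b₂

  no-two-representations : ∀ {n i j} → i < j → j < c → Representation n i → Representation n j → ⊥
  no-two-representations {n} {i} {j} i<j j<c (y , n≡i) (y′ , n≡j) =
    ℕ.<⇒≱ d<c (∣⇒≤ {{ℕ.>-nonZero 0<d}} c∣d)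
    where
    d : ℕ
    d = j ∸ i
    0<d : 0 < d
    0<d = ℕ.m<n⇒0<n∸m i<j
    d<c : d < c
    d<c = ℕ.≤-<-trans (ℕ.m∸n≤m j i) j<c
    y*b₂≡ : y ℕ.* b₂ ≡ y′ ℕ.* b₂ ℕ.+ d ℕ.* b₁
    y*b₂≡ = ℕ.+-cancelˡ-≡ (i ℕ.* b₁) _ _ (begin
      i ℕ.* b₁ ℕ.+ y ℕ.* b₂                       ≡⟨ trans (sym n≡i) n≡j ⟩
      j ℕ.* b₁ ℕ.+ y′ ℕ.* b₂
        ≡⟨ cong (λ j → j ℕ.* b₁ ℕ.+ y′ ℕ.* b₂) (ℕ.m+[n∸m]≡n (ℕ.<⇒≤ i<j)) ⟨
      (i ℕ.+ d) ℕ.* b₁ ℕ.+ y′ ℕ.* b₂              ≡⟨ ℕ-solve i d b₁ (y′ ℕ.* b₂) ⟩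
      i ℕ.* b₁ ℕ.+ (y′ ℕ.* b₂ ℕ.+ d ℕ.* b₁)       ∎)
      where
      open ≡-Reasoning
      ℕ-solve : ∀ i d b z → (i ℕ.+ d) ℕ.* b ℕ.+ z ≡ i ℕ.* b ℕ.+ (z ℕ.+ d ℕ.* b)
      ℕ-solve = ℕ-solve-∀
    lcm∣d*b₁ : lcm b₁ b₂ ∣ d ℕ.* b₁
    lcm∣d*b₁ = lcm-least (n∣m*n d) (∣m+n∣m⇒∣n (subst (b₂ ∣_) y*b₂≡ (n∣m*n y)) (n∣m*n y′))
    c∣d : c ∣ d
    c∣d = *-cancelʳ-∣ b₁ (subst (_∣ d ℕ.* b₁) lcm≡c*b₁ lcm∣d*b₁)

  representation-unique : ∀ {n i j} → i < c → j < c → Representation n i → Representation n j → i ≡ j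
  representation-unique {n} {i} {j} i<c j<c (y , n≡i) (y′ , n≡j) with ℕ.<-cmp i j
  ... | tri< i<j _ _ = ⊥-elim (no-two-representations i<j j<c (y , n≡i) (y′ , n≡j))
  ... | tri≈ _ i≡j _ = i≡j
  ... | tri> _ _ j<i = ⊥-elim (no-two-representations j<i i<c (y′ , n≡j) (y , n≡i))

  inSpan⇒representation : ∀ {n} → InSpan n b₁ b₂ → ∃[ i ] (i < c × Representation n i)
  inSpan⇒representation {n} (x , y , n≡) = i , m%n<n x c , t ℕ.* e ℕ.+ y , (begin
    n                                         ≡⟨ n≡ ⟩
    x ℕ.* b₁ ℕ.+ y ℕ.* b₂                     ≡⟨ cong (λ x → x ℕ.* b₁ ℕ.+ y ℕ.* b₂) (m≡m%n+[m/n]*n x c) ⟩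
    (i ℕ.+ t ℕ.* c) ℕ.* b₁ ℕ.+ y ℕ.* b₂       ≡⟨ ℕ-solve i t c b₁ (y ℕ.* b₂) ⟩
    i ℕ.* b₁ ℕ.+ (t ℕ.* (c ℕ.* b₁) ℕ.+ y ℕ.* b₂)
      ≡⟨ cong (λ l → i ℕ.* b₁ ℕ.+ (t ℕ.* l ℕ.+ y ℕ.* b₂)) (trans (sym lcm≡c*b₁) lcm≡e*b₂) ⟩
    i ℕ.* b₁ ℕ.+ (t ℕ.* (e ℕ.* b₂) ℕ.+ y ℕ.* b₂)  ≡⟨ cong (λ z → i ℕ.* b₁ ℕ.+ z) (ℕ-solve′ t e b₂ y) ⟩
    i ℕ.* b₁ ℕ.+ (t ℕ.* e ℕ.+ y) ℕ.* b₂       ∎)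
    where
    open ≡-Reasoning
    instance
      c≢0 : NonZero c
      c≢0 = nonZero-factor {{lcm-nonZero 1≤b₁ 1≤b₂}} lcm≡c*b₁
    i t e : ℕ
    i = x % c
    t = x / c
    e = _∣_.quotient (n∣lcm[m,n] b₁ b₂)
    lcm≡e*b₂ : lcm b₁ b₂ ≡ e ℕ.* b₂
    lcm≡e*b₂ = _∣_.equality (n∣lcm[m,n] b₁ b₂)
    ℕ-solve : ∀ i t c b z → (i ℕ.+ t ℕ.* c) ℕ.* b ℕ.+ z ≡ i ℕ.* b ℕ.+ (t ℕ.* (c ℕ.* b) ℕ.+ z)
    ℕ-solve = ℕ-solve-∀
    ℕ-solve′ : ∀ t e b y → t ℕ.* (e ℕ.* b) ℕ.+ y ℕ.* b ≡ (t ℕ.* e ℕ.+ y) ℕ.* b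
    ℕ-solve′ = ℕ-solve-∀

  spanIndicator-isIndicator : ∀ n → IsIndicator (InSpan n b₁ b₂) (spanIndicator n)
  spanIndicator-isIndicator n =
    subst (IsIndicator (InSpan n b₁ b₂)) (sym (multiplesBelow-⊛ b₁ c (multiples b₂) n))
      (isIndicator-resp (λ { (i , _ , y , n≡) → i , y , n≡ }) inSpan⇒representation
        (sumBelow-isIndicator c
          (λ i → shift-multiples-isIndicator (i ℕ.* b₁) b₂ n)
          representation-unique))

  spanIndicator-periodic : ∀ n → lcm b₁ b₂ ≤ n → spanIndicator (n ℕ.+ gcd b₁ b₂) ≡ spanIndicator n
  spanIndicator-periodic n lcm≤n =
    isIndicator-unique
      (λ n+g∈span → large-multiple-of-gcd⇒inSpan 1≤b₁ 1≤b₂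
                      (∣m+n∣m⇒∣n (subst (gcd b₁ b₂ ∣_) (ℕ.+-comm n _) (inSpan⇒gcd∣ n+g∈span)) ∣-refl)
                      lcm≤n)
      (λ n∈span → large-multiple-of-gcd⇒inSpan 1≤b₁ 1≤b₂
                    (∣m∣n⇒∣m+n (inSpan⇒gcd∣ n∈span) ∣-refl) (ℕ.≤-trans lcm≤n (ℕ.m≤m+n n _)))
      (spanIndicator-isIndicator (n ℕ.+ gcd b₁ b₂)) (spanIndicator-isIndicator n)

  1-q^-⊛-spanIndicator-nonneg : ∀ {a} → InSpan a b₁ b₂ → Nonneg ((1-q^ a) ⊛ spanIndicator)
  1-q^-⊛-spanIndicator-nonneg {a} a∈span =
    1-q^-⊛-indicator-nonneg a spanIndicator-isIndicator (λ _ → inSpan-+ a∈span)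

  quotient-factorization : ∀ k a₂ →
    quotient (k ℕ.* lcm b₁ b₂) a₂ b₁ b₂ ≗ multiplesBelow (lcm b₁ b₂) k ⊛ ((1-q^ a₂) ⊛ spanIndicator)
  quotient-factorization k a₂ = begin
    (1-q^ (k ℕ.* l)) ⊛ ((1-q^ a₂) ⊛ M)            ≈⟨ 1-q^-multiple-⊛ l k ((1-q^ a₂) ⊛ M) ⟩
    multiplesBelow l k ⊛ ((1-q^ l) ⊛ ((1-q^ a₂) ⊛ M))
      ≈⟨ ⊛-congʳ (multiplesBelow l k)
                 (solve 3 (λ x y m → x ⊕ (y ⊕ m) ⊜ y ⊕ (x ⊕ m)) ≗-refl (1-q^ l) (1-q^ a₂) M) ⟩
    multiplesBelow l k ⊛ ((1-q^ a₂) ⊛ ((1-q^ l) ⊛ M))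
      ≈⟨ ⊛-congʳ (multiplesBelow l k) (⊛-congʳ (1-q^ a₂) 1-q^lcm-⊛-multiples²) ⟩
    multiplesBelow l k ⊛ ((1-q^ a₂) ⊛ spanIndicator) ∎
    where
    open ≗-Reasoning
    l : ℕ
    l = lcm b₁ b₂
    M : Series
    M = multiples b₁ ⊛ multiples b₂

  1-q^-⊛-spanIndicator-finiteSupport : ∀ {a} → gcd b₁ b₂ ∣ a → FiniteSupport ((1-q^ a) ⊛ spanIndicator)
  1-q^-⊛-spanIndicator-finiteSupport (divides r refl) =
    finiteSupport-resp-≗ (≗-sym (1-q^-multiple-⊛ (gcd b₁ b₂) r spanIndicator))
      (⊛-finiteSupport (multiplesBelow-finiteSupport (gcd b₁ b₂) r)
        (lcm b₁ b₂ ℕ.+ gcd b₁ b₂ , 1-q^-⊛-vanishesFrom-periodic (gcd b₁ b₂) spanIndicator-periodic))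

  lcm∣⇒quotient-finiteSupport : ∀ {a₁ a₂} → lcm b₁ b₂ ∣ a₁ → gcd b₁ b₂ ∣ a₂ →
                                FiniteSupport (quotient a₁ a₂ b₁ b₂)
  lcm∣⇒quotient-finiteSupport {a₂ = a₂} (divides k refl) g∣a₂ =
    finiteSupport-resp-≗ (≗-sym (quotient-factorization k a₂))
      (⊛-finiteSupport (multiplesBelow-finiteSupport (lcm b₁ b₂) k)
                       (1-q^-⊛-spanIndicator-finiteSupport g∣a₂))

  lcm∣⇒quotient-nonneg : ∀ {a₁ a₂} → lcm b₁ b₂ ∣ a₁ → InSpan a₂ b₁ b₂ → Nonneg (quotient a₁ a₂ b₁ b₂)
  lcm∣⇒quotient-nonneg {a₂ = a₂} (divides k refl) a₂∈span =
    nonneg-resp-≗ (≗-sym (quotient-factorization k a₂))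
      (⊛-nonneg (multiplesBelow-nonneg (lcm b₁ b₂) k) (1-q^-⊛-spanIndicator-nonneg a₂∈span))

-- Sufficiency

module _ {b₁ b₂} (1≤b₁ : 1 ≤ b₁) (1≤b₂ : 1 ≤ b₂) where
  open SpanIndicator 1≤b₁ 1≤b₂ using (lcm∣⇒quotient-finiteSupport; lcm∣⇒quotient-nonneg)

  quotient-multiples : ∀ k₁ k₂ →
    quotient (k₁ ℕ.* b₁) (k₂ ℕ.* b₂) b₁ b₂ ≗ multiplesBelow b₁ k₁ ⊛ multiplesBelow b₂ k₂
  quotient-multiples k₁ k₂ = begin
    (1-q^ (k₁ ℕ.* b₁)) ⊛ ((1-q^ (k₂ ℕ.* b₂)) ⊛ (multiples b₁ ⊛ multiples b₂))
      ≈⟨ solve 4 (λ x y m₁ m₂ → x ⊕ (y ⊕ (m₁ ⊕ m₂)) ⊜ (x ⊕ m₁) ⊕ (y ⊕ m₂))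
               ≗-refl (1-q^ (k₁ ℕ.* b₁)) (1-q^ (k₂ ℕ.* b₂)) (multiples b₁) (multiples b₂) ⟩
    ((1-q^ (k₁ ℕ.* b₁)) ⊛ multiples b₁) ⊛ ((1-q^ (k₂ ℕ.* b₂)) ⊛ multiples b₂)
      ≈⟨ ⊛-cong (1-q^-multiple-⊛-multiples 1≤b₁ k₁) (1-q^-multiple-⊛-multiples 1≤b₂ k₂) ⟩
    multiplesBelow b₁ k₁ ⊛ multiplesBelow b₂ k₂ ∎
    where open ≗-Reasoning

  divides⇒quotient-finiteSupport : ∀ {a₁ a₂} → b₁ ∣ a₁ → b₂ ∣ a₂ → FiniteSupport (quotient a₁ a₂ b₁ b₂)
  divides⇒quotient-finiteSupport (divides k₁ refl) (divides k₂ refl) =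
    finiteSupport-resp-≗ (≗-sym (quotient-multiples k₁ k₂))
      (⊛-finiteSupport (multiplesBelow-finiteSupport b₁ k₁) (multiplesBelow-finiteSupport b₂ k₂))

  divides⇒quotient-nonneg : ∀ {a₁ a₂} → b₁ ∣ a₁ → b₂ ∣ a₂ → Nonneg (quotient a₁ a₂ b₁ b₂)
  divides⇒quotient-nonneg (divides k₁ refl) (divides k₂ refl) =
    nonneg-resp-≗ (≗-sym (quotient-multiples k₁ k₂))
      (⊛-nonneg (multiplesBelow-nonneg b₁ k₁) (multiplesBelow-nonneg b₂ k₂))

  divCond⇒quotient-finiteSupport : ∀ {a₁ a₂} → DivCond a₁ a₂ b₁ b₂ → FiniteSupport (quotient a₁ a₂ b₁ b₂)
  divCond⇒quotient-finiteSupport (inj₁ (b₁∣a₁ , b₂∣a₂)) = divides⇒quotient-finiteSupport b₁∣a₁ b₂∣a₂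
  divCond⇒quotient-finiteSupport {a₁} {a₂} (inj₂ (inj₁ (b₁∣a₂ , b₂∣a₁))) =
    finiteSupport-resp-≗ (quotient-swap a₂ a₁ b₁ b₂) (divides⇒quotient-finiteSupport b₁∣a₂ b₂∣a₁)
  divCond⇒quotient-finiteSupport (inj₂ (inj₂ (inj₁ (b₁∣a₁ , b₂∣a₁ , g∣a₂)))) =
    lcm∣⇒quotient-finiteSupport (lcm-least b₁∣a₁ b₂∣a₁) g∣a₂
  divCond⇒quotient-finiteSupport {a₁} {a₂} (inj₂ (inj₂ (inj₂ (b₁∣a₂ , b₂∣a₂ , g∣a₁)))) =
    finiteSupport-resp-≗ (quotient-swap a₂ a₁ b₁ b₂)
                         (lcm∣⇒quotient-finiteSupport (lcm-least b₁∣a₂ b₂∣a₂) g∣a₁)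

  divCond⇒inSpan⇒quotient-nonneg : ∀ {a₁ a₂} → DivCond a₁ a₂ b₁ b₂ → InSpan a₁ b₁ b₂ → InSpan a₂ b₁ b₂ →
    Nonneg (quotient a₁ a₂ b₁ b₂)
  divCond⇒inSpan⇒quotient-nonneg (inj₁ (b₁∣a₁ , b₂∣a₂)) _ _ = divides⇒quotient-nonneg b₁∣a₁ b₂∣a₂
  divCond⇒inSpan⇒quotient-nonneg {a₁} {a₂} (inj₂ (inj₁ (b₁∣a₂ , b₂∣a₁))) _ _ =
    nonneg-resp-≗ (quotient-swap a₂ a₁ b₁ b₂) (divides⇒quotient-nonneg b₁∣a₂ b₂∣a₁)
  divCond⇒inSpan⇒quotient-nonneg (inj₂ (inj₂ (inj₁ (b₁∣a₁ , b₂∣a₁ , _)))) _ a₂∈span =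
    lcm∣⇒quotient-nonneg (lcm-least b₁∣a₁ b₂∣a₁) a₂∈span
  divCond⇒inSpan⇒quotient-nonneg {a₁} {a₂} (inj₂ (inj₂ (inj₂ (b₁∣a₂ , b₂∣a₂ , _)))) a₁∈span _ =
    nonneg-resp-≗ (quotient-swap a₂ a₁ b₁ b₂) (lcm∣⇒quotient-nonneg (lcm-least b₁∣a₂ b₂∣a₂) a₁∈span)

lemma3p7 : (a₁ a₂ b₁ b₂ : ℕ) → 0 < a₁ → 0 < a₂ → 0 < b₁ → 0 < b₂ →
    (IsPolynomial a₁ a₂ b₁ b₂ ⇔ DivCond a₁ a₂ b₁ b₂)
    × (HasNonnegExpansion a₁ a₂ b₁ b₂ → InSpan a₁ b₁ b₂ × InSpan a₂ b₁ b₂)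
    × (IsBasicCGF a₁ a₂ b₁ b₂ ⇔ (DivCond a₁ a₂ b₁ b₂ × InSpan a₁ b₁ b₂ × InSpan a₂ b₁ b₂))
lemma3p7 a₁ a₂ b₁ b₂ 0<a₁ 0<a₂ 0<b₁ 0<b₂ =
  mk⇔ (polynomial⇒divCond 0<a₁ 0<a₂)
      (λ divCond → f , f-expansion , divCond⇒quotient-finiteSupport 0<b₁ 0<b₂ divCond) ,
  inSpan ,
  mk⇔ (λ (P , expansion , finite , P≥0) →
         polynomial⇒divCond 0<a₁ 0<a₂ (P , expansion , finite) , inSpan (P , expansion , P≥0))
      (λ (divCond , a₁∈span , a₂∈span) →
         f , f-expansion , divCond⇒quotient-finiteSupport 0<b₁ 0<b₂ divCond ,
         divCond⇒inSpan⇒quotient-nonneg 0<b₁ 0<b₂ divCond a₁∈span a₂∈span)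
  where
  f : Series
  f = quotient a₁ a₂ b₁ b₂
  f-expansion : IsExpansion a₁ a₂ b₁ b₂ f
  f-expansion = quotient-isExpansion 0<b₁ 0<b₂ a₁ a₂
  inSpan : HasNonnegExpansion a₁ a₂ b₁ b₂ → InSpan a₁ b₁ b₂ × InSpan a₂ b₁ b₂
  inSpan (P , expansion , P≥0) =
    nonneg-expansion⇒inSpan {a₁} {a₂} 0<a₂ 0<b₁ 0<b₂ expansion P≥0 ,
    nonneg-expansion⇒inSpan {a₂} {a₁} 0<a₁ 0<b₁ 0<b₂
                            (isExpansion-swap {a₁} {a₂} {b₁} {b₂} {P} expansion) P≥0
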